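{- For all structures $R,T$ and every atom $a$, writing $\vdash X$ for "$X$ has a proof in $\mathsf{BVr}$": (1) $\vdash\langle R;T\rangle$ if and only if $\vdash R$ and $\vdash T$; (2) $\vdash(R;T)$ if and only if $\vdash R$ and $\vdash T$; (3) $\vdash\forall a.R$ if and only if $\vdash R\{b/a\}$ for every atom $b$.
   Context: Fix a countable set of atoms $a,b,\dots$ with negations $\bar a$ ($\bar{\bar a}=a$). Structures: $R::=\circ\mid a\mid \bar a\mid [R;T]\mid (R;T)\mid \langle R;T\rangle\mid \forall a.R$ ($\circ$ unit, par $[\,;\,]$, copar $(\,;\,)$, seq $\langle\,;\,\rangle$, self-dual renaming $\forall a.R$, also written $\exists a.R$, binding $a$ and $\bar a$ in $R$). $R\{b/a\}$ is capture-free substitution of $b$ for free occurrences of $a$ and $\bar b$ for $\bar a$. Structures are taken modulo the congruence $\approx$ making par, copar, seq associative with unit $\circ$, par and copar commutative, with $\forall a.R\approx\forall b.R\{b/a\}$ ($b$ not free in $R$), $\forall a.R\approx R$ ($a$ not free in $R$), $\forall a.\forall b.R\approx\forall b.\forall a.R$. Rules of $\mathsf{BVr}$ (premise $\Rightarrow$ conclusion, in any one-hole context $S\{\ \}$): $\mathsf{ai}\downarrow: S\{\circ\}\Rightarrow S[a;\bar a]$; $\mathsf{s}: S([R;U];T)\Rightarrow S[(R;T);U]$; $\mathsf{q}\downarrow: S\langle[R;U];[T;V]\rangle\Rightarrow S[\langle R;T\rangle;\langle U;V\rangle]$; $\mathsf{r}\downarrow: S\{\forall a.[R;T]\}\Rightarrow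 S[\forall a.R;\forall a.T]$. A proof of $X$ is a finite sequence of rule instances (structures up to $\approx$) from premise $\circ$ to conclusion $X$. -}

module Defs where

open import Data.Nat using (ℕ; suc; _⊔_; _≡ᵇ_)
open import Data.Bool using (Bool; true; false; if_then_else_; _∨_; _∧_; not)
open import Data.Product using (Σ; _×_; _,_)
open import Relation.Binary.PropositionalEquality using (_≡_)

Atom : Set
Atom = ℕ

-- Structures.  `at a` is the atom a, `neg a` is its negation ā
-- (so ā̄ = a is built in: neg of neg is not a structure, ā̄ is `at a`).
data Str : Set where
  ◦    : Str
  at   : Atom → Str
  neg  : Atom → Str
  par  : Str → Str → Str     -- [R;T]
  cop  : Str → Str → Str     -- (R;T)
  seq  : Str → Str → Str     -- ⟨R;T⟩
  new  : Atom → Str → Str    -- ∀a.R  (self-dual renaming), binds a and ā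

freeIn : Atom → Str → Bool
freeIn a ◦         = false
freeIn a (at x)    = a ≡ᵇ x
freeIn a (neg x)   = a ≡ᵇ x
freeIn a (par R T) = freeIn a R ∨ freeIn a T
freeIn a (cop R T) = freeIn a R ∨ freeIn a T
freeIn a (seq R T) = freeIn a R ∨ freeIn a T
freeIn a (new c R) = not (a ≡ᵇ c) ∧ freeIn a R

maxImg : (Atom → Atom) → Str → ℕ
maxImg σ ◦         = 0
maxImg σ (at x)    = σ x
maxImg σ (neg x)   = σ x
maxImg σ (par R T) = maxImg σ R ⊔ maxImg σ T
maxImg σ (cop R T) = maxImg σ R ⊔ maxImg σ T
maxImg σ (seq R T) = maxImg σ R ⊔ maxImg σ T
maxImg σ (new c R) = σ c ⊔ maxImg σ R

_[_↦_] : (Atom → Atom) → Atom → Atom → (Atom → Atom)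
(σ [ c ↦ d ]) x = if x ≡ᵇ c then d else σ x

-- Capture-avoiding simultaneous renaming of free atoms; every binder is
-- renamed to an atom fresh for the image of σ on R (so no capture occurs).
rename : (Atom → Atom) → Str → Str
rename σ ◦         = ◦
rename σ (at x)    = at (σ x)
rename σ (neg x)   = neg (σ x)
rename σ (par R T) = par (rename σ R) (rename σ T)
rename σ (cop R T) = cop (rename σ R) (rename σ T)
rename σ (seq R T) = seq (rename σ R) (rename σ T)
rename σ (new c R) = new d (rename (σ [ c ↦ d ]) R)
  where d = suc (maxImg σ (new c R))

-- R{b/a}: capture-free substitution of b for free a (and b̄ for ā)
_⟪_/_⟫ : Str → Atom → Atom → Str
R ⟪ b / a ⟫ = rename (λ x → if x ≡ᵇ a then b else x) R

infix 4 _≈_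
data _≈_ : Str → Str → Set where
  ≈-refl  : ∀ {R} → R ≈ R
  ≈-sym   : ∀ {R T} → R ≈ T → T ≈ R
  ≈-trans : ∀ {R T U} → R ≈ T → T ≈ U → R ≈ U
  ≈-par   : ∀ {R R' T T'} → R ≈ R' → T ≈ T' → par R T ≈ par R' T'
  ≈-cop   : ∀ {R R' T T'} → R ≈ R' → T ≈ T' → cop R T ≈ cop R' T'
  ≈-seq   : ∀ {R R' T T'} → R ≈ R' → T ≈ T' → seq R T ≈ seq R' T'
  ≈-new   : ∀ {a R R'} → R ≈ R' → new a R ≈ new a R'
  par-assoc : ∀ {R T U} → par (par R T) U ≈ par R (par T U)
  cop-assoc : ∀ {R T U} → cop (cop R T) U ≈ cop R (cop T U)
  seq-assoc : ∀ {R T U} → seq (seq R T) U ≈ seq R (seq T U)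
  par-unit  : ∀ {R} → par ◦ R ≈ R
  cop-unit  : ∀ {R} → cop ◦ R ≈ R
  seq-unitˡ : ∀ {R} → seq ◦ R ≈ R
  seq-unitʳ : ∀ {R} → seq R ◦ ≈ R
  par-comm  : ∀ {R T} → par R T ≈ par T R
  cop-comm  : ∀ {R T} → cop R T ≈ cop T R
  new-α     : ∀ {a b R} → freeIn b R ≡ false → new a R ≈ new b (R ⟪ b / a ⟫)
  new-vac   : ∀ {a R} → freeIn a R ≡ false → new a R ≈ R
  new-swap  : ∀ {a b R} → new a (new b R) ≈ new b (new a R)

data Ctx : Set where
  hole  : Ctx
  parL  : Ctx → Str → Ctx
  parR  : Str → Ctx → Ctx
  copL  : Ctx → Str → Ctx
  copR  : Str → Ctx → Ctx
  seqL  : Ctx → Str → Ctx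
  seqR  : Str → Ctx → Ctx
  newC  : Atom → Ctx → Ctx

_⟦_⟧ : Ctx → Str → Str
hole ⟦ X ⟧       = X
parL S T ⟦ X ⟧   = par (S ⟦ X ⟧) T
parR T S ⟦ X ⟧   = par T (S ⟦ X ⟧)
copL S T ⟦ X ⟧   = cop (S ⟦ X ⟧) T
copR T S ⟦ X ⟧   = cop T (S ⟦ X ⟧)
seqL S T ⟦ X ⟧   = seq (S ⟦ X ⟧) T
seqR T S ⟦ X ⟧   = seq T (S ⟦ X ⟧)
newC a S ⟦ X ⟧   = new a (S ⟦ X ⟧)

-- Rule instances of BVr: Rule premise conclusion
data Rule : Str → Str → Set where
  ai↓ : ∀ S a       → Rule (S ⟦ ◦ ⟧) (S ⟦ par (at a) (neg a) ⟧)
  s   : ∀ S R T U   → Rule (S ⟦ cop (par R U) T ⟧) (S ⟦ par (cop R T) U ⟧)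
  q↓  : ∀ S R T U V → Rule (S ⟦ seq (par R U) (par T V) ⟧)
                           (S ⟦ par (seq R T) (seq U V) ⟧)
  r↓  : ∀ S a R T   → Rule (S ⟦ new a (par R T) ⟧) (S ⟦ par (new a R) (new a T) ⟧)

infix 3 ⊢_
data ⊢_ : Str → Set where
  start : ⊢ ◦
  step  : ∀ {P Q} → ⊢ P → Rule P Q → ⊢ Q
  conv  : ∀ {P Q} → ⊢ P → P ≈ Q → ⊢ Q

module Submission where

-- Introduction runs the given proofs side by side in a context, resp.
-- α-converts an instance at an unused atom.  A colouring marks each atom occurrence kept or deleted and
-- each binder expanded, retained or vacuous; it is admissible if across every
-- par no kept atom meets a deleted one and no expanded binder a retained one,
-- and vacuous binders bind nothing.  Its interpretation at an atom c deletes
-- the deleted atoms and replaces each expanded ∀a by {c/a}.  For c fresh,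
-- every rule instance and every ≈-step pulls admissible colourings of its
-- conclusion back to its premise, so interpretations of provable structures
-- are provable.  Deleting one side of ⟨R;T⟩ or (R;T) gives (1) and (2);
-- expanding the binder of ∀a.R proves R{c/a}, and provability is closed under
-- renaming (⊢-rename), which turns c into any b and gives (3).

open import Defs
open import Data.Bool using (true; false; T; not; _∧_; _∨_)
open import Data.Bool.Properties using (T-≡; ¬-not; ∨-assoc; ∨-comm; ∨-identityʳ; ∨-zeroʳ)
open import Data.Empty using (⊥; ⊥-elim)
open import Data.Nat using (ℕ; suc; _⊔_; _≡ᵇ_; _<_; _≤_; s≤s)
open import Data.Nat.Properties
  using (≡ᵇ⇒≡; ≡⇒≡ᵇ; _≟_; n≮n; ≤-refl; ≤-trans; <⇒≢; m≤m⊔n; m≤n⊔m; m⊔n<o⇒m<o; m⊔n<o⇒n<o; n≤1+n; 1+n≢n)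
open import Data.Product using (Σ-syntax; ∃-syntax; _×_; _,_; proj₁; assocʳ′; assocˡ′) renaming (swap to ×-swap)
open import Data.Sum using (_⊎_; inj₁; inj₂; [_,_]; [_,_]′) renaming (map to ⊎-map; map₁ to ⊎-map₁; map₂ to ⊎-map₂; swap to ⊎-swap; assocʳ to ⊎-assocʳ; assocˡ to ⊎-assocˡ)
open import Data.Unit using (⊤; tt)
open import Function using (id; _∘_)
open import Function.Bundles using (_⇔_; mk⇔; Equivalence)
open import Relation.Binary.Construct.Closure.ReflexiveTransitive using (Star; ε; _◅_; _◅◅_; gmap)
open import Relation.Binary.PropositionalEquality
  using (_≡_; _≢_; refl; sym; trans; cong; cong₂; subst; subst₂)
open import Relation.Nullary using (¬_; yes; no)

≡ᵇ-refl : ∀ m → (m ≡ᵇ m) ≡ true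
≡ᵇ-refl m = Equivalence.to T-≡ (≡⇒≡ᵇ m m refl)

≡ᵇ-sound : ∀ m n → (m ≡ᵇ n) ≡ true → m ≡ n
≡ᵇ-sound m n eq = ≡ᵇ⇒≡ m n (Equivalence.from T-≡ eq)

≡ᵇ-false : ∀ {m n} → m ≢ n → (m ≡ᵇ n) ≡ false
≡ᵇ-false {m} {n} m≢n = ¬-not (m≢n ∘ ≡ᵇ-sound m n)

≡ᵇ-false⁻ : ∀ m n → (m ≡ᵇ n) ≡ false → m ≢ n
≡ᵇ-false⁻ m n eq refl with trans (sym eq) (≡ᵇ-refl m)
... | ()

[_≔_] : Atom → Atom → Atom → Atom
[ a ≔ b ] = id [ a ↦ b ]

update-hit : ∀ σ c d → (σ [ c ↦ d ]) c ≡ d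
update-hit σ c d rewrite ≡ᵇ-refl c = refl

update-miss : ∀ σ c d {x} → x ≢ c → (σ [ c ↦ d ]) x ≡ σ x
update-miss σ c d x≢c rewrite ≡ᵇ-false x≢c = refl

-- Free atoms as an inductive relation; it is equivalent to the boolean test
-- freeIn of Defs, but can be inverted by pattern matching.
infix 4 _∈fv_ _∉fv_
data _∈fv_ (y : Atom) : Str → Set where
  at   : y ∈fv at y
  neg  : y ∈fv neg y
  parˡ : ∀ {R T} → y ∈fv R → y ∈fv par R T
  parʳ : ∀ {R T} → y ∈fv T → y ∈fv par R T
  copˡ : ∀ {R T} → y ∈fv R → y ∈fv cop R T
  copʳ : ∀ {R T} → y ∈fv T → y ∈fv cop R T
  seqˡ : ∀ {R T} → y ∈fv R → y ∈fv seq R T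
  seqʳ : ∀ {R T} → y ∈fv T → y ∈fv seq R T
  new  : ∀ {c R} → y ≢ c → y ∈fv R → y ∈fv new c R

_∉fv_ : Atom → Str → Set
y ∉fv R = ¬ (y ∈fv R)

∈fv⇒freeIn : ∀ {y R} → y ∈fv R → freeIn y R ≡ true
∈fv⇒freeIn {y} at = ≡ᵇ-refl y
∈fv⇒freeIn {y} neg = ≡ᵇ-refl y
∈fv⇒freeIn (parˡ p) rewrite ∈fv⇒freeIn p = refl
∈fv⇒freeIn (parʳ p) rewrite ∈fv⇒freeIn p = ∨-zeroʳ _
∈fv⇒freeIn (copˡ p) rewrite ∈fv⇒freeIn p = refl
∈fv⇒freeIn (copʳ p) rewrite ∈fv⇒freeIn p = ∨-zeroʳ _
∈fv⇒freeIn (seqˡ p) rewrite ∈fv⇒freeIn p = refl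
∈fv⇒freeIn (seqʳ p) rewrite ∈fv⇒freeIn p = ∨-zeroʳ _
∈fv⇒freeIn (new y≢c p) rewrite ≡ᵇ-false y≢c = ∈fv⇒freeIn p

freeIn⇒∈fv : ∀ {y} R → freeIn y R ≡ true → y ∈fv R
freeIn⇒∈fv ◦ ()
freeIn⇒∈fv {y} (at x) eq with ≡ᵇ-sound y x eq
... | refl = at
freeIn⇒∈fv {y} (neg x) eq with ≡ᵇ-sound y x eq
... | refl = neg
freeIn⇒∈fv {y} (par R T) eq with freeIn y R in eqR
... | true = parˡ (freeIn⇒∈fv R eqR)
... | false = parʳ (freeIn⇒∈fv T eq)
freeIn⇒∈fv {y} (cop R T) eq with freeIn y R in eqR
... | true = copˡ (freeIn⇒∈fv R eqR)
... | false = copʳ (freeIn⇒∈fv T eq)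
freeIn⇒∈fv {y} (seq R T) eq with freeIn y R in eqR
... | true = seqˡ (freeIn⇒∈fv R eqR)
... | false = seqʳ (freeIn⇒∈fv T eq)
freeIn⇒∈fv {y} (new c R) eq with y ≡ᵇ c in eqc
... | false = new (≡ᵇ-false⁻ y c eqc) (freeIn⇒∈fv R eq)

fresh⇒∉fv : ∀ {y R} → freeIn y R ≡ false → y ∉fv R
fresh⇒∉fv eq p with trans (sym eq) (∈fv⇒freeIn p)
... | ()

∉fv⇒fresh : ∀ {y} R → y ∉fv R → freeIn y R ≡ false
∉fv⇒fresh R y∉R = ¬-not λ eq → y∉R (freeIn⇒∈fv R eq)

freeIn-ext : ∀ y P Q → (y ∈fv P → y ∈fv Q) → (y ∈fv Q → y ∈fv P) → freeIn y P ≡ freeIn y Q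
freeIn-ext y P Q to from with freeIn y P in eqP | freeIn y Q in eqQ
... | false | false = refl
... | true | true = refl
... | true | false = ⊥-elim (fresh⇒∉fv eqQ (to (freeIn⇒∈fv P eqP)))
... | false | true = ⊥-elim (fresh⇒∉fv eqP (from (freeIn⇒∈fv Q eqQ)))

binder : (Atom → Atom) → Atom → Str → Atom
binder σ c R = suc (maxImg σ (new c R))

∈fv-maxImg : ∀ σ {y X} → y ∈fv X → σ y ≤ maxImg σ X
∈fv-maxImg σ at = ≤-refl
∈fv-maxImg σ neg = ≤-refl
∈fv-maxImg σ (parˡ p) = ≤-trans (∈fv-maxImg σ p) (m≤m⊔n _ _)
∈fv-maxImg σ (parʳ p) = ≤-trans (∈fv-maxImg σ p) (m≤n⊔m _ _)
∈fv-maxImg σ (copˡ p) = ≤-trans (∈fv-maxImg σ p) (m≤m⊔n _ _)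
∈fv-maxImg σ (copʳ p) = ≤-trans (∈fv-maxImg σ p) (m≤n⊔m _ _)
∈fv-maxImg σ (seqˡ p) = ≤-trans (∈fv-maxImg σ p) (m≤m⊔n _ _)
∈fv-maxImg σ (seqʳ p) = ≤-trans (∈fv-maxImg σ p) (m≤n⊔m _ _)
∈fv-maxImg σ (new _ p) = ≤-trans (∈fv-maxImg σ p) (m≤n⊔m _ _)

binder-fresh : ∀ σ {x c R} → x ∈fv new c R → σ x ≢ binder σ c R
binder-fresh σ p = <⇒≢ (s≤s (∈fv-maxImg σ p))

∈fv-rename : ∀ σ {x R} → x ∈fv R → σ x ∈fv rename σ R
∈fv-rename σ at = at
∈fv-rename σ neg = neg
∈fv-rename σ (parˡ p) = parˡ (∈fv-rename σ p)
∈fv-rename σ (parʳ p) = parʳ (∈fv-rename σ p)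
∈fv-rename σ (copˡ p) = copˡ (∈fv-rename σ p)
∈fv-rename σ (copʳ p) = copʳ (∈fv-rename σ p)
∈fv-rename σ (seqˡ p) = seqˡ (∈fv-rename σ p)
∈fv-rename σ (seqʳ p) = seqʳ (∈fv-rename σ p)
∈fv-rename σ {x} (new {c} {R} x≢c p) =
  new (binder-fresh σ (new x≢c p))
      (subst (_∈fv rename σ′ R) (update-miss σ c (binder σ c R) x≢c) (∈fv-rename σ′ p))
  where σ′ = σ [ c ↦ binder σ c R ]

along : ∀ {σ : Atom → Atom} {R R′ y} → (∀ {x} → x ∈fv R → x ∈fv R′) →
        ∃[ x ] (x ∈fv R × σ x ≡ y) → ∃[ x ] (x ∈fv R′ × σ x ≡ y)
along f (x , p , e) = x , f p , e

∈fv-rename⁻ : ∀ σ R {y} → y ∈fv rename σ R → ∃[ x ] (x ∈fv R × σ x ≡ y)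
∈fv-rename⁻ σ (at x) at = x , at , refl
∈fv-rename⁻ σ (neg x) neg = x , neg , refl
∈fv-rename⁻ σ (par R T) (parˡ p) = along parˡ (∈fv-rename⁻ σ R p)
∈fv-rename⁻ σ (par R T) (parʳ p) = along parʳ (∈fv-rename⁻ σ T p)
∈fv-rename⁻ σ (cop R T) (copˡ p) = along copˡ (∈fv-rename⁻ σ R p)
∈fv-rename⁻ σ (cop R T) (copʳ p) = along copʳ (∈fv-rename⁻ σ T p)
∈fv-rename⁻ σ (seq R T) (seqˡ p) = along seqˡ (∈fv-rename⁻ σ R p)
∈fv-rename⁻ σ (seq R T) (seqʳ p) = along seqʳ (∈fv-rename⁻ σ T p)
∈fv-rename⁻ σ (new c R) (new y≢d p) with ∈fv-rename⁻ (σ [ c ↦ binder σ c R ]) R p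
... | x , q , e with x ≟ c
...   | yes refl = ⊥-elim (y≢d (trans (sym e) (update-hit σ x _)))
...   | no x≢c = x , new x≢c q , trans (sym (update-miss σ c _ x≢c)) e

Agree : (Atom → Atom) → (Atom → Atom) → Str → Set
Agree σ τ R = ∀ {x} → x ∈fv R → σ x ≡ τ x

-- A binder may be renamed to any atom d that captures nothing.  Stated for R
-- given the two facts below for R itself, so that they can be proved together.
rename-new-from : ∀ R →
  (∀ σ τ → Agree σ τ R → rename σ R ≈ rename τ R) →
  (∀ σ τ → rename σ (rename τ R) ≈ rename (σ ∘ τ) R) →
  ∀ σ c d → (∀ {x} → x ∈fv new c R → σ x ≢ d) →
  rename σ (new c R) ≈ new d (rename (σ [ c ↦ d ]) R)
rename-new-from R rename-cong-R rename-∘-R σ c d captures-nothing with binder σ c R ≟ d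
... | yes refl = ≈-refl
... | no d₀≢d = ≈-trans (new-α (∉fv⇒fresh _ d-fresh))
                        (≈-new (≈-trans (rename-∘-R [ d₀ ≔ d ] σ₀) (rename-cong-R _ _ agree)))
  where
  d₀ = binder σ c R
  σ₀ = σ [ c ↦ d₀ ]
  d-fresh : d ∉fv rename σ₀ R
  d-fresh p with ∈fv-rename⁻ σ₀ R p
  ... | x , q , e with x ≟ c
  ...   | yes refl = d₀≢d (trans (sym (update-hit σ x d₀)) e)
  ...   | no x≢c = captures-nothing (new x≢c q) (trans (sym (update-miss σ c d₀ x≢c)) e)
  agree : Agree ([ d₀ ≔ d ] ∘ σ₀) (σ [ c ↦ d ]) R
  agree {x} q with x ≟ c
  ... | yes refl rewrite update-hit σ x d₀ | update-hit σ x d = update-hit id d₀ d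
  ... | no x≢c rewrite update-miss σ c d₀ x≢c | update-miss σ c d x≢c =
    update-miss id d₀ d (binder-fresh σ (new x≢c q))

mutual
  rename-cong : ∀ R σ τ → Agree σ τ R → rename σ R ≈ rename τ R
  rename-cong ◦ σ τ agree = ≈-refl
  rename-cong (at x) σ τ agree rewrite agree at = ≈-refl
  rename-cong (neg x) σ τ agree rewrite agree neg = ≈-refl
  rename-cong (par R T) σ τ agree = ≈-par (rename-cong R σ τ (agree ∘ parˡ)) (rename-cong T σ τ (agree ∘ parʳ))
  rename-cong (cop R T) σ τ agree = ≈-cop (rename-cong R σ τ (agree ∘ copˡ)) (rename-cong T σ τ (agree ∘ copʳ))
  rename-cong (seq R T) σ τ agree = ≈-seq (rename-cong R σ τ (agree ∘ seqˡ)) (rename-cong T σ τ (agree ∘ seqʳ))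
  rename-cong (new c R) σ τ agree =
    ≈-trans (≈-new (rename-cong R (σ [ c ↦ d ]) (τ [ c ↦ d ]) agree′))
            (≈-sym (rename-new-from R (rename-cong R) (rename-∘ R) τ c d captures-nothing))
    where
    d = binder σ c R
    agree′ : Agree (σ [ c ↦ d ]) (τ [ c ↦ d ]) R
    agree′ {x} p with x ≟ c
    ... | yes refl rewrite update-hit σ x d | update-hit τ x d = refl
    ... | no x≢c rewrite update-miss σ c d x≢c | update-miss τ c d x≢c = agree (new x≢c p)
    captures-nothing : ∀ {x} → x ∈fv new c R → τ x ≢ d
    captures-nothing p = binder-fresh σ p ∘ trans (agree p)

  rename-∘ : ∀ R σ τ → rename σ (rename τ R) ≈ rename (σ ∘ τ) R
  rename-∘ ◦ σ τ = ≈-refl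
  rename-∘ (at x) σ τ = ≈-refl
  rename-∘ (neg x) σ τ = ≈-refl
  rename-∘ (par R T) σ τ = ≈-par (rename-∘ R σ τ) (rename-∘ T σ τ)
  rename-∘ (cop R T) σ τ = ≈-cop (rename-∘ R σ τ) (rename-∘ T σ τ)
  rename-∘ (seq R T) σ τ = ≈-seq (rename-∘ R σ τ) (rename-∘ T σ τ)
  rename-∘ (new c R) σ τ =
    ≈-trans (≈-new (rename-∘ R σ₁ τ₁))
            (≈-trans (≈-new (rename-cong R (σ₁ ∘ τ₁) ((σ ∘ τ) [ c ↦ d₂ ]) agree))
                     (≈-sym (rename-new-from R (rename-cong R) (rename-∘ R) (σ ∘ τ) c d₂ captures-nothing)))
    where
    d₁ = binder τ c R
    τ₁ = τ [ c ↦ d₁ ]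
    d₂ = binder σ d₁ (rename τ₁ R)
    σ₁ = σ [ d₁ ↦ d₂ ]
    agree : Agree (σ₁ ∘ τ₁) ((σ ∘ τ) [ c ↦ d₂ ]) R
    agree {x} p with x ≟ c
    ... | yes refl rewrite update-hit τ x d₁ | update-hit σ d₁ d₂ | update-hit (σ ∘ τ) x d₂ = refl
    ... | no x≢c rewrite update-miss τ c d₁ x≢c | update-miss (σ ∘ τ) c d₂ x≢c =
      update-miss σ d₁ d₂ (binder-fresh τ (new x≢c p))
    captures-nothing : ∀ {x} → x ∈fv new c R → σ (τ x) ≢ d₂
    captures-nothing (new x≢c p) =
      binder-fresh σ (new (binder-fresh τ (new x≢c p))
                          (subst (_∈fv rename τ₁ R) (update-miss τ c d₁ x≢c) (∈fv-rename τ₁ p)))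

rename-new : ∀ R σ c d → (∀ {x} → x ∈fv new c R → σ x ≢ d) →
             rename σ (new c R) ≈ new d (rename (σ [ c ↦ d ]) R)
rename-new R = rename-new-from R (rename-cong R) (rename-∘ R)

rename-id : ∀ R σ → Agree σ id R → rename σ R ≈ R
rename-id ◦ σ fixes = ≈-refl
rename-id (at x) σ fixes rewrite fixes at = ≈-refl
rename-id (neg x) σ fixes rewrite fixes neg = ≈-refl
rename-id (par R T) σ fixes = ≈-par (rename-id R σ (fixes ∘ parˡ)) (rename-id T σ (fixes ∘ parʳ))
rename-id (cop R T) σ fixes = ≈-cop (rename-id R σ (fixes ∘ copˡ)) (rename-id T σ (fixes ∘ copʳ))
rename-id (seq R T) σ fixes = ≈-seq (rename-id R σ (fixes ∘ seqˡ)) (rename-id T σ (fixes ∘ seqʳ))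
rename-id (new c R) σ fixes =
  ≈-trans (rename-new R σ c c captures-nothing) (≈-new (rename-id R (σ [ c ↦ c ]) fixes′))
  where
  captures-nothing : ∀ {x} → x ∈fv new c R → σ x ≢ c
  captures-nothing p@(new x≢c _) = x≢c ∘ trans (sym (fixes p))
  fixes′ : Agree (σ [ c ↦ c ]) id R
  fixes′ {x} p with x ≟ c
  ... | yes refl = update-hit σ x x
  ... | no x≢c = trans (update-miss σ c c x≢c) (fixes (new x≢c p))

∈fv-⟪⟫ : ∀ {a b y R} → y ≢ a → y ∈fv R → y ∈fv R ⟪ b / a ⟫
∈fv-⟪⟫ {a} {b} y≢a p = subst (_∈fv _) (update-miss id a b y≢a) (∈fv-rename [ a ≔ b ] p)

∈fv-⟪⟫⁻ : ∀ {a b y} R → y ∈fv R ⟪ b / a ⟫ → (y ≡ b × a ∈fv R) ⊎ (y ≢ a × y ∈fv R)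
∈fv-⟪⟫⁻ {a} {b} R p with ∈fv-rename⁻ [ a ≔ b ] R p
... | x , q , e with x ≟ a
...   | yes refl = inj₁ (trans (sym e) (update-hit id x b) , q)
...   | no x≢a with trans (sym (update-miss id a b x≢a)) e
...     | refl = inj₂ (x≢a , q)

fv-≈ : ∀ {P Q} → P ≈ Q → ∀ y → freeIn y P ≡ freeIn y Q
fv-≈ ≈-refl y = refl
fv-≈ (≈-sym e) y = sym (fv-≈ e y)
fv-≈ (≈-trans e e′) y = trans (fv-≈ e y) (fv-≈ e′ y)
fv-≈ (≈-par e e′) y = cong₂ _∨_ (fv-≈ e y) (fv-≈ e′ y)
fv-≈ (≈-cop e e′) y = cong₂ _∨_ (fv-≈ e y) (fv-≈ e′ y)
fv-≈ (≈-seq e e′) y = cong₂ _∨_ (fv-≈ e y) (fv-≈ e′ y)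
fv-≈ (≈-new {a} e) y = cong (not (y ≡ᵇ a) ∧_) (fv-≈ e y)
fv-≈ (par-assoc {R} {T} {U}) y = ∨-assoc (freeIn y R) (freeIn y T) (freeIn y U)
fv-≈ (cop-assoc {R} {T} {U}) y = ∨-assoc (freeIn y R) (freeIn y T) (freeIn y U)
fv-≈ (seq-assoc {R} {T} {U}) y = ∨-assoc (freeIn y R) (freeIn y T) (freeIn y U)
fv-≈ par-unit y = refl
fv-≈ cop-unit y = refl
fv-≈ seq-unitˡ y = refl
fv-≈ (seq-unitʳ {R}) y = ∨-identityʳ (freeIn y R)
fv-≈ (par-comm {R} {T}) y = ∨-comm (freeIn y R) (freeIn y T)
fv-≈ (cop-comm {R} {T}) y = ∨-comm (freeIn y R) (freeIn y T)
fv-≈ (new-α {a} {b} {R} b∉R) y = freeIn-ext y (new a R) (new b (R ⟪ b / a ⟫)) to from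
  where
  to : y ∈fv new a R → y ∈fv new b (R ⟪ b / a ⟫)
  to (new y≢a p) = new (λ { refl → fresh⇒∉fv b∉R p }) (∈fv-⟪⟫ y≢a p)
  from : y ∈fv new b (R ⟪ b / a ⟫) → y ∈fv new a R
  from (new y≢b p) with ∈fv-⟪⟫⁻ R p
  ... | inj₁ (y≡b , _) = ⊥-elim (y≢b y≡b)
  ... | inj₂ (y≢a , q) = new y≢a q
fv-≈ (new-vac {a} {R} a∉R) y = freeIn-ext y (new a R) R (λ { (new _ p) → p })
  (λ p → new (λ { refl → fresh⇒∉fv a∉R p }) p)
fv-≈ (new-swap {a} {b} {R}) y = freeIn-ext y (new a (new b R)) (new b (new a R))
  (λ { (new y≢a (new y≢b p)) → new y≢b (new y≢a p) })
  (λ { (new y≢b (new y≢a p)) → new y≢a (new y≢b p) })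

∈fv-≈ : ∀ {P Q y} → P ≈ Q → y ∈fv P → y ∈fv Q
∈fv-≈ {Q = Q} e p = freeIn⇒∈fv Q (trans (sym (fv-≈ e _)) (∈fv⇒freeIn p))

rename-α : ∀ σ a b R → freeIn b R ≡ false →
           rename σ (new a R) ≈ rename σ (new b (R ⟪ b / a ⟫))
rename-α σ a b R b∉R =
  ≈-sym (≈-trans (rename-new (R ⟪ b / a ⟫) σ b d captures-nothing)
                 (≈-new (≈-trans (rename-∘ R (σ [ b ↦ d ]) [ a ≔ b ]) (rename-cong R _ _ agree))))
  where
  d = binder σ a R
  captures-nothing : ∀ {x} → x ∈fv new b (R ⟪ b / a ⟫) → σ x ≢ d
  captures-nothing p = binder-fresh σ (∈fv-≈ (≈-sym (new-α b∉R)) p)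
  agree : Agree ((σ [ b ↦ d ]) ∘ [ a ≔ b ]) (σ [ a ↦ d ]) R
  agree {z} p with z ≟ a
  ... | yes refl rewrite update-hit id z b | update-hit σ b d | update-hit σ z d = refl
  ... | no z≢a rewrite update-miss id a b z≢a | update-miss σ a d z≢a =
    update-miss σ b d (λ { refl → fresh⇒∉fv b∉R p })

rename-vac : ∀ σ a R → freeIn a R ≡ false → rename σ (new a R) ≈ rename σ R
rename-vac σ a R a∉R = ≈-trans (≈-new (rename-cong R _ _ agree)) (new-vac (∉fv⇒fresh _ d-fresh))
  where
  d = binder σ a R
  z≢a : ∀ {z} → z ∈fv R → z ≢ a
  z≢a p refl = fresh⇒∉fv a∉R p
  agree : Agree (σ [ a ↦ d ]) σ R
  agree p = update-miss σ a d (z≢a p)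
  d-fresh : d ∉fv rename σ R
  d-fresh p with ∈fv-rename⁻ σ R p
  ... | z , q , e = binder-fresh σ (new (z≢a q) q) e

update-comm : ∀ σ {a b F G} → a ≢ b → ∀ z → ((σ [ a ↦ F ]) [ b ↦ G ]) z ≡ ((σ [ b ↦ G ]) [ a ↦ F ]) z
update-comm σ {a} {b} {F} {G} a≢b z with z ≟ a | z ≟ b
... | yes refl | yes refl = ⊥-elim (a≢b refl)
... | yes refl | no z≢b
  rewrite update-miss (σ [ z ↦ F ]) b G z≢b | update-hit σ z F | update-hit (σ [ b ↦ G ]) z F = refl
... | no z≢a | yes refl
  rewrite update-hit (σ [ a ↦ F ]) z G | update-miss (σ [ z ↦ G ]) a F z≢a | update-hit σ z G = refl
... | no z≢a | no z≢b
  rewrite update-miss (σ [ a ↦ F ]) b G z≢b | update-miss σ a F z≢a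
        | update-miss (σ [ b ↦ G ]) a F z≢a | update-miss σ b G z≢b = refl

rename-swap : ∀ σ a b R → rename σ (new a (new b R)) ≈ rename σ (new b (new a R))
rename-swap σ a b R with a ≟ b
... | yes refl = ≈-refl
... | no a≢b =
  ≈-trans (rename-new (new b R) σ a F (below-F ∘ ≤-F))
   (≈-trans (≈-new (rename-new R (σ [ a ↦ F ]) b G captures-nothing-G))
    (≈-trans new-swap
     (≈-trans (≈-new (≈-new (rename-cong R _ _ (λ {z} _ → update-comm σ a≢b z))))
      (≈-sym (≈-trans (rename-new (new a R) σ b G (below-G ∘ ≤-F ∘ swap-fv))
                      (≈-new (rename-new R (σ [ b ↦ G ]) a F captures-nothing-F)))))))
  where
  K = maxImg σ (new a (new b R))
  F = suc K
  G = suc (suc K)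
  ≤-F : ∀ {x} → x ∈fv new a (new b R) → σ x ≤ K
  ≤-F = ∈fv-maxImg σ
  below-F : ∀ {m} → m ≤ K → m ≢ F
  below-F m≤K = <⇒≢ (s≤s m≤K)
  below-G : ∀ {m} → m ≤ K → m ≢ G
  below-G m≤K = <⇒≢ (s≤s (≤-trans m≤K (n≤1+n K)))
  swap-fv : ∀ {x} → x ∈fv new b (new a R) → x ∈fv new a (new b R)
  swap-fv (new x≢b (new x≢a p)) = new x≢a (new x≢b p)
  captures-nothing-G : ∀ {x} → x ∈fv new b R → (σ [ a ↦ F ]) x ≢ G
  captures-nothing-G {x} p with x ≟ a
  ... | yes refl rewrite update-hit σ x F = 1+n≢n ∘ sym
  ... | no x≢a rewrite update-miss σ a F x≢a = below-G (≤-F (new x≢a p))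
  captures-nothing-F : ∀ {x} → x ∈fv new a R → (σ [ b ↦ G ]) x ≢ F
  captures-nothing-F {x} p with x ≟ b
  ... | yes refl rewrite update-hit σ x G = 1+n≢n
  ... | no x≢b rewrite update-miss σ b G x≢b = below-F (≤-F (swap-fv (new x≢b p)))

⟪⟫-vacuous : ∀ {a b} R → a ∉fv R → R ⟪ b / a ⟫ ≈ R
⟪⟫-vacuous {a} {b} R a∉R = rename-id R [ a ≔ b ] λ p → update-miss id a b (λ { refl → a∉R p })

rename-under : ∀ σ b X → σ b ≡ b → (∀ {z} → z ∈fv new b X → σ z ≢ b) →
               rename σ (new b X) ≈ new b (rename σ X)
rename-under σ b X σb≡b captures-nothing =
  ≈-trans (rename-new X σ b b captures-nothing) (≈-new (rename-cong X _ _ agree))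
  where
  agree : Agree (σ [ b ↦ b ]) σ X
  agree {z} _ with z ≟ b
  ... | yes refl = trans (update-hit σ z z) (sym σb≡b)
  ... | no z≢b = update-miss σ b b z≢b

⟪⟫-under : ∀ {x y c} X → x ≢ y → y ≢ c → (new y X) ⟪ c / x ⟫ ≈ new y (X ⟪ c / x ⟫)
⟪⟫-under {x} {y} {c} X x≢y y≢c = rename-under [ x ≔ c ] y X (update-miss id x c (x≢y ∘ sym)) captures-nothing
  where
  captures-nothing : ∀ {z} → z ∈fv new y X → [ x ≔ c ] z ≢ y
  captures-nothing {z} (new z≢y _) with z ≟ x
  ... | yes refl rewrite update-hit id z c = y≢c ∘ sym
  ... | no z≢x rewrite update-miss id x c z≢x = z≢y

rename-≈ : ∀ {P Q} → P ≈ Q → ∀ σ → rename σ P ≈ rename σ Q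
rename-≈ ≈-refl σ = ≈-refl
rename-≈ (≈-sym e) σ = ≈-sym (rename-≈ e σ)
rename-≈ (≈-trans e e′) σ = ≈-trans (rename-≈ e σ) (rename-≈ e′ σ)
rename-≈ (≈-par e e′) σ = ≈-par (rename-≈ e σ) (rename-≈ e′ σ)
rename-≈ (≈-cop e e′) σ = ≈-cop (rename-≈ e σ) (rename-≈ e′ σ)
rename-≈ (≈-seq e e′) σ = ≈-seq (rename-≈ e σ) (rename-≈ e′ σ)
rename-≈ (≈-new {a} {R} {R′} e) σ =
  ≈-trans (≈-new (rename-≈ e (σ [ a ↦ d ])))
          (≈-sym (rename-new R′ σ a d (binder-fresh σ ∘ ∈fv-≈ (≈-sym (≈-new e)))))
  where d = binder σ a R
rename-≈ par-assoc σ = par-assoc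
rename-≈ cop-assoc σ = cop-assoc
rename-≈ seq-assoc σ = seq-assoc
rename-≈ par-unit σ = par-unit
rename-≈ cop-unit σ = cop-unit
rename-≈ seq-unitˡ σ = seq-unitˡ
rename-≈ seq-unitʳ σ = seq-unitʳ
rename-≈ par-comm σ = par-comm
rename-≈ cop-comm σ = cop-comm
rename-≈ (new-α {a} {b} {R} b∉R) σ = rename-α σ a b R b∉R
rename-≈ (new-vac {a} {R} a∉R) σ = rename-vac σ a R a∉R
rename-≈ (new-swap {a} {b} {R}) σ = rename-swap σ a b R

_∘C_ : Ctx → Ctx → Ctx
hole ∘C S′ = S′
parL S T ∘C S′ = parL (S ∘C S′) T
parR T S ∘C S′ = parR T (S ∘C S′)
copL S T ∘C S′ = copL (S ∘C S′) T
copR T S ∘C S′ = copR T (S ∘C S′)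
seqL S T ∘C S′ = seqL (S ∘C S′) T
seqR T S ∘C S′ = seqR T (S ∘C S′)
newC a S ∘C S′ = newC a (S ∘C S′)

plug-∘C : ∀ S S′ X → (S ∘C S′) ⟦ X ⟧ ≡ S ⟦ S′ ⟦ X ⟧ ⟧
plug-∘C hole S′ X = refl
plug-∘C (parL S T) S′ X = cong (λ Z → par Z T) (plug-∘C S S′ X)
plug-∘C (parR T S) S′ X = cong (par T) (plug-∘C S S′ X)
plug-∘C (copL S T) S′ X = cong (λ Z → cop Z T) (plug-∘C S S′ X)
plug-∘C (copR T S) S′ X = cong (cop T) (plug-∘C S S′ X)
plug-∘C (seqL S T) S′ X = cong (λ Z → seq Z T) (plug-∘C S S′ X)
plug-∘C (seqR T S) S′ X = cong (seq T) (plug-∘C S S′ X)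
plug-∘C (newC a S) S′ X = cong (new a) (plug-∘C S S′ X)

rule-ctx : ∀ S {P Q} → Rule P Q → Rule (S ⟦ P ⟧) (S ⟦ Q ⟧)
rule-ctx S (ai↓ S′ a) = subst₂ Rule (plug-∘C S S′ _) (plug-∘C S S′ _) (ai↓ (S ∘C S′) a)
rule-ctx S (s S′ R T U) = subst₂ Rule (plug-∘C S S′ _) (plug-∘C S S′ _) (s (S ∘C S′) R T U)
rule-ctx S (q↓ S′ R T U V) = subst₂ Rule (plug-∘C S S′ _) (plug-∘C S S′ _) (q↓ (S ∘C S′) R T U V)
rule-ctx S (r↓ S′ a R T) = subst₂ Rule (plug-∘C S S′ _) (plug-∘C S S′ _) (r↓ (S ∘C S′) a R T)

≈-ctx : ∀ S {X Y} → X ≈ Y → S ⟦ X ⟧ ≈ S ⟦ Y ⟧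
≈-ctx hole e = e
≈-ctx (parL S T) e = ≈-par (≈-ctx S e) ≈-refl
≈-ctx (parR T S) e = ≈-par ≈-refl (≈-ctx S e)
≈-ctx (copL S T) e = ≈-cop (≈-ctx S e) ≈-refl
≈-ctx (copR T S) e = ≈-cop ≈-refl (≈-ctx S e)
≈-ctx (seqL S T) e = ≈-seq (≈-ctx S e) ≈-refl
≈-ctx (seqR T S) e = ≈-seq ≈-refl (≈-ctx S e)
≈-ctx (newC a S) e = ≈-new (≈-ctx S e)

-- Reduction paths: finite sequences of rule instances and ≈-steps.  Unlike
-- derivations they may start anywhere, so they can be put into contexts.
Step : Str → Str → Set
Step P Q = Rule P Q ⊎ P ≈ Q

infix 3 _⇝_
_⇝_ : Str → Str → Set
_⇝_ = Star Step

⇝-rule : ∀ {P Q} → Rule P Q → P ⇝ Q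
⇝-rule r = inj₁ r ◅ ε

⇝-≈ : ∀ {P Q} → P ≈ Q → P ⇝ Q
⇝-≈ e = inj₂ e ◅ ε

⇝-ctx : ∀ S {P Q} → P ⇝ Q → S ⟦ P ⟧ ⇝ S ⟦ Q ⟧
⇝-ctx S = gmap (S ⟦_⟧) [ inj₁ ∘ rule-ctx S , inj₂ ∘ ≈-ctx S ]

extend : ∀ {P Q} → ⊢ P → P ⇝ Q → ⊢ Q
extend d ε = d
extend d (inj₁ r ◅ p) = extend (step d r) p
extend d (inj₂ e ◅ p) = extend (conv d e) p

path : ∀ {X} → ⊢ X → ◦ ⇝ X
path start = ε
path (step d r) = path d ◅◅ ⇝-rule r
path (conv d e) = path d ◅◅ ⇝-≈ e

seq-intro : ∀ {R T} → ⊢ R → ⊢ T → ⊢ seq R T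
seq-intro {R} dR dT =
  extend start (⇝-≈ (≈-sym seq-unitˡ) ◅◅ ⇝-ctx (seqL hole ◦) (path dR) ◅◅ ⇝-ctx (seqR R hole) (path dT))

cop-intro : ∀ {R T} → ⊢ R → ⊢ T → ⊢ cop R T
cop-intro {R} dR dT =
  extend start (⇝-≈ (≈-sym cop-unit) ◅◅ ⇝-ctx (copL hole ◦) (path dR) ◅◅ ⇝-ctx (copR R hole) (path dT))

new-intro : ∀ a {R} → ⊢ R → ⊢ new a R
new-intro a dR = extend start (⇝-≈ (≈-sym (new-vac refl)) ◅◅ ⇝-ctx (newC a hole) (path dR))

-- Renaming a rule instance yields a reduction path between the renamed
-- structures (binders may be renamed differently on the two sides).
RenamesTo : Str → Str → Set
RenamesTo P Q = ∀ σ → rename σ P ⇝ rename σ Q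

renames-ctx : ∀ S {P Q} → RenamesTo P Q → RenamesTo (S ⟦ P ⟧) (S ⟦ Q ⟧)
renames-ctx hole r σ = r σ
renames-ctx (parL S T) r σ = ⇝-ctx (parL hole _) (renames-ctx S r σ)
renames-ctx (parR T S) r σ = ⇝-ctx (parR _ hole) (renames-ctx S r σ)
renames-ctx (copL S T) r σ = ⇝-ctx (copL hole _) (renames-ctx S r σ)
renames-ctx (copR T S) r σ = ⇝-ctx (copR _ hole) (renames-ctx S r σ)
renames-ctx (seqL S T) r σ = ⇝-ctx (seqL hole _) (renames-ctx S r σ)
renames-ctx (seqR T S) r σ = ⇝-ctx (seqR _ hole) (renames-ctx S r σ)
renames-ctx (newC a S) {P} {Q} r σ =
  ⇝-≈ (rename-new X σ a F λ p → below (≤-trans (∈fv-maxImg σ p) (m≤m⊔n (maxImg σ (new a X)) _)))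
  ◅◅ ⇝-ctx (newC F hole) (renames-ctx S r (σ [ a ↦ F ]))
  ◅◅ ⇝-≈ (≈-sym (rename-new Y σ a F λ p → below (≤-trans (∈fv-maxImg σ p) (m≤n⊔m (maxImg σ (new a X)) _))))
  where
  X = S ⟦ P ⟧
  Y = S ⟦ Q ⟧
  F = suc (maxImg σ (new a X) ⊔ maxImg σ (new a Y))
  below : ∀ {m} → m ≤ maxImg σ (new a X) ⊔ maxImg σ (new a Y) → m ≢ F
  below m≤ = <⇒≢ (s≤s m≤)

-- Every rule instance renames to a reduction path; for r↓ the two sides
-- choose the same binder up to rename-new.
rule-renames : ∀ {P Q} → Rule P Q → RenamesTo P Q
rule-renames (ai↓ S a) = renames-ctx S λ σ → ⇝-rule (ai↓ hole (σ a))
rule-renames (s S R T U) = renames-ctx S λ σ → ⇝-rule (s hole _ _ _)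
rule-renames (q↓ S R T U V) = renames-ctx S λ σ → ⇝-rule (q↓ hole _ _ _ _)
rule-renames (r↓ S a R T) = renames-ctx S medial
  where
  medial : RenamesTo (new a (par R T)) (par (new a R) (new a T))
  medial σ = ⇝-rule (r↓ hole d _ _)
           ◅◅ ⇝-≈ (≈-par (≈-sym (rename-new R σ a d λ { (new x≢a p) → binder-fresh σ {R = par R T} (new x≢a (parˡ p)) }))
                         (≈-sym (rename-new T σ a d λ { (new x≢a p) → binder-fresh σ {R = par R T} (new x≢a (parʳ p)) })))
    where d = binder σ a (par R T)

⇝-rename : ∀ {P Q} → P ⇝ Q → RenamesTo P Q
⇝-rename ε σ = ε
⇝-rename (inj₁ r ◅ p) σ = rule-renames r σ ◅◅ ⇝-rename p σ
⇝-rename (inj₂ e ◅ p) σ = ⇝-≈ (rename-≈ e σ) ◅◅ ⇝-rename p σ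

⊢-rename : ∀ {X} → ⊢ X → ∀ σ → ⊢ rename σ X
⊢-rename d σ = extend start (⇝-rename (path d) σ)

-- A colouring marks each atom occurrence as kept or deleted and each binder
-- as expanded (its atom becomes the fixed atom c), retained, or vacuous.  The
-- marks of the two sides of a par may not clash.
data Mark : Set where
  kept deleted expanded retained : Mark

data Clash : Mark → Mark → Set where
  kept-deleted      : Clash kept deleted
  deleted-kept      : Clash deleted kept
  expanded-retained : Clash expanded retained
  retained-expanded : Clash retained expanded

clash-sym : ∀ {m n} → Clash m n → Clash n m
clash-sym kept-deleted = deleted-kept
clash-sym deleted-kept = kept-deleted
clash-sym expanded-retained = retained-expanded
clash-sym retained-expanded = expanded-retained

MarkSet : Set₁
MarkSet = Mark → Set

∅ : MarkSet
∅ _ = ⊥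

infixr 6 _∪_
infix 4 _⊆_

_∪_ : MarkSet → MarkSet → MarkSet
(p ∪ q) m = p m ⊎ q m

_⊆_ : MarkSet → MarkSet → Set
p ⊆ q = ∀ {m} → p m → q m

⊆-≡ : ∀ {p q} → p ≡ q → p ⊆ q
⊆-≡ refl = id

Compatible : MarkSet → MarkSet → Set
Compatible p q = ∀ {m n} → Clash m n → p m → q n → ⊥

compatible-mono : ∀ {p p′ q q′} → p′ ⊆ p → q′ ⊆ q → Compatible p q → Compatible p′ q′
compatible-mono p′⊆p q′⊆q ok cl x y = ok cl (p′⊆p x) (q′⊆q y)

compatible-sym : ∀ {p q} → Compatible p q → Compatible q p
compatible-sym ok cl x y = ok (clash-sym cl) y x

compatible-∪ : ∀ {p q r} → Compatible p r → Compatible q r → Compatible (p ∪ q) r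
compatible-∪ ok ok′ cl = [ ok cl , ok′ cl ]

data AtomColour : Set where
  keep delete : AtomColour

data BinderColour : Set where
  expand retain vacuous : BinderColour

atomMarks : AtomColour → MarkSet
atomMarks keep m = m ≡ kept
atomMarks delete m = m ≡ deleted

binderMarks : BinderColour → MarkSet
binderMarks expand m = m ≡ expanded
binderMarks retain m = m ≡ retained
binderMarks vacuous = ∅

Colouring : Str → Set
Colouring ◦ = ⊤
Colouring (at x) = AtomColour
Colouring (neg x) = AtomColour
Colouring (par R T) = Colouring R × Colouring T
Colouring (cop R T) = Colouring R × Colouring T
Colouring (seq R T) = Colouring R × Colouring T
Colouring (new a R) = BinderColour × Colouring R

marks : (X : Str) → Colouring X → MarkSet
marks ◦ _ = ∅
marks (at x) k = atomMarks k
marks (neg x) k = atomMarks k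
marks (par R T) (u , v) = marks R u ∪ marks T v
marks (cop R T) (u , v) = marks R u ∪ marks T v
marks (seq R T) (u , v) = marks R u ∪ marks T v
marks (new a R) (k , u) = binderMarks k ∪ marks R u

Admissible : (X : Str) → Colouring X → Set
Admissible ◦ _ = ⊤
Admissible (at x) _ = ⊤
Admissible (neg x) _ = ⊤
Admissible (par R T) (u , v) = Admissible R u × Admissible T v × Compatible (marks R u) (marks T v)
Admissible (cop R T) (u , v) = Admissible R u × Admissible T v
Admissible (seq R T) (u , v) = Admissible R u × Admissible T v
Admissible (new a R) (k , u) = Admissible R u × (k ≡ vacuous → a ∉fv R)

interpret : Atom → (X : Str) → Colouring X → Str
interpret c ◦ _ = ◦
interpret c (at x) keep = at x
interpret c (at x) delete = ◦
interpret c (neg x) keep = neg x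
interpret c (neg x) delete = ◦
interpret c (par R T) (u , v) = par (interpret c R u) (interpret c T v)
interpret c (cop R T) (u , v) = cop (interpret c R u) (interpret c T v)
interpret c (seq R T) (u , v) = seq (interpret c R u) (interpret c T v)
interpret c (new a R) (expand , u) = interpret c R u ⟪ c / a ⟫
interpret c (new a R) (retain , u) = new a (interpret c R u)
interpret c (new a R) (vacuous , u) = new a (interpret c R u)

∈fv-interpret : ∀ c X u {y} → y ∈fv interpret c X u → y ∈fv X ⊎ y ≡ c
∈fv-interpret c (at x) keep at = inj₁ at
∈fv-interpret c (neg x) keep neg = inj₁ neg
∈fv-interpret c (par R T) (u , v) (parˡ p) = ⊎-map₁ parˡ (∈fv-interpret c R u p)
∈fv-interpret c (par R T) (u , v) (parʳ p) = ⊎-map₁ parʳ (∈fv-interpret c T v p)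
∈fv-interpret c (cop R T) (u , v) (copˡ p) = ⊎-map₁ copˡ (∈fv-interpret c R u p)
∈fv-interpret c (cop R T) (u , v) (copʳ p) = ⊎-map₁ copʳ (∈fv-interpret c T v p)
∈fv-interpret c (seq R T) (u , v) (seqˡ p) = ⊎-map₁ seqˡ (∈fv-interpret c R u p)
∈fv-interpret c (seq R T) (u , v) (seqʳ p) = ⊎-map₁ seqʳ (∈fv-interpret c T v p)
∈fv-interpret c (new a R) (expand , u) p with ∈fv-⟪⟫⁻ (interpret c R u) p
... | inj₁ (y≡c , _) = inj₂ y≡c
... | inj₂ (y≢a , q) = ⊎-map₁ (new y≢a) (∈fv-interpret c R u q)
∈fv-interpret c (new a R) (retain , u) (new y≢a p) = ⊎-map₁ (new y≢a) (∈fv-interpret c R u p)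
∈fv-interpret c (new a R) (vacuous , u) (new y≢a p) = ⊎-map₁ (new y≢a) (∈fv-interpret c R u p)

∉fv-interpret : ∀ c X u {y} → y ∉fv X → y ≢ c → y ∉fv interpret c X u
∉fv-interpret c X u y∉X y≢c p = [ y∉X , y≢c ] (∈fv-interpret c X u p)

recolour : ∀ σ R → Colouring R → Colouring (rename σ R)
recolour σ ◦ u = u
recolour σ (at x) k = k
recolour σ (neg x) k = k
recolour σ (par R T) (u , v) = recolour σ R u , recolour σ T v
recolour σ (cop R T) (u , v) = recolour σ R u , recolour σ T v
recolour σ (seq R T) (u , v) = recolour σ R u , recolour σ T v
recolour σ (new a R) (k , u) = k , recolour (σ [ a ↦ binder σ a R ]) R u

uncolour : ∀ σ R → Colouring (rename σ R) → Colouring R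
uncolour σ ◦ u = u
uncolour σ (at x) k = k
uncolour σ (neg x) k = k
uncolour σ (par R T) (u , v) = uncolour σ R u , uncolour σ T v
uncolour σ (cop R T) (u , v) = uncolour σ R u , uncolour σ T v
uncolour σ (seq R T) (u , v) = uncolour σ R u , uncolour σ T v
uncolour σ (new a R) (k , u) = k , uncolour (σ [ a ↦ binder σ a R ]) R u

uncolour-recolour : ∀ σ R u → uncolour σ R (recolour σ R u) ≡ u
uncolour-recolour σ ◦ u = refl
uncolour-recolour σ (at x) k = refl
uncolour-recolour σ (neg x) k = refl
uncolour-recolour σ (par R T) (u , v) = cong₂ _,_ (uncolour-recolour σ R u) (uncolour-recolour σ T v)
uncolour-recolour σ (cop R T) (u , v) = cong₂ _,_ (uncolour-recolour σ R u) (uncolour-recolour σ T v)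
uncolour-recolour σ (seq R T) (u , v) = cong₂ _,_ (uncolour-recolour σ R u) (uncolour-recolour σ T v)
uncolour-recolour σ (new a R) (k , u) = cong (k ,_) (uncolour-recolour _ R u)

marks-recolour : ∀ σ R u → marks (rename σ R) (recolour σ R u) ≡ marks R u
marks-recolour σ ◦ u = refl
marks-recolour σ (at x) k = refl
marks-recolour σ (neg x) k = refl
marks-recolour σ (par R T) (u , v) = cong₂ _∪_ (marks-recolour σ R u) (marks-recolour σ T v)
marks-recolour σ (cop R T) (u , v) = cong₂ _∪_ (marks-recolour σ R u) (marks-recolour σ T v)
marks-recolour σ (seq R T) (u , v) = cong₂ _∪_ (marks-recolour σ R u) (marks-recolour σ T v)
marks-recolour σ (new a R) (k , u) = cong (binderMarks k ∪_) (marks-recolour _ R u)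

marks-uncolour : ∀ σ R u → marks R (uncolour σ R u) ≡ marks (rename σ R) u
marks-uncolour σ ◦ u = refl
marks-uncolour σ (at x) k = refl
marks-uncolour σ (neg x) k = refl
marks-uncolour σ (par R T) (u , v) = cong₂ _∪_ (marks-uncolour σ R u) (marks-uncolour σ T v)
marks-uncolour σ (cop R T) (u , v) = cong₂ _∪_ (marks-uncolour σ R u) (marks-uncolour σ T v)
marks-uncolour σ (seq R T) (u , v) = cong₂ _∪_ (marks-uncolour σ R u) (marks-uncolour σ T v)
marks-uncolour σ (new a R) (k , u) = cong (binderMarks k ∪_) (marks-uncolour _ R u)

binder-vacuous : ∀ σ a R → a ∉fv R → binder σ a R ∉fv rename (σ [ a ↦ binder σ a R ]) R
binder-vacuous σ a R a∉R p with ∈fv-rename⁻ (σ [ a ↦ binder σ a R ]) R p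
... | x , q , e with x ≟ a
...   | yes refl = a∉R q
...   | no x≢a = binder-fresh σ (new x≢a q) (trans (sym (update-miss σ a _ x≢a)) e)

binder-vacuous⁻ : ∀ σ a R → binder σ a R ∉fv rename (σ [ a ↦ binder σ a R ]) R → a ∉fv R
binder-vacuous⁻ σ a R d∉ p = d∉ (subst (_∈fv rename (σ [ a ↦ binder σ a R ]) R) (update-hit σ a _) (∈fv-rename (σ [ a ↦ binder σ a R ]) p))

admissible-recolour : ∀ σ R u → Admissible R u → Admissible (rename σ R) (recolour σ R u)
admissible-recolour σ ◦ u ok = ok
admissible-recolour σ (at x) k ok = ok
admissible-recolour σ (neg x) k ok = ok
admissible-recolour σ (par R T) (u , v) (okR , okT , compat) =
  admissible-recolour σ R u okR , admissible-recolour σ T v okT ,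
  subst₂ Compatible (sym (marks-recolour σ R u)) (sym (marks-recolour σ T v)) compat
admissible-recolour σ (cop R T) (u , v) (okR , okT) = admissible-recolour σ R u okR , admissible-recolour σ T v okT
admissible-recolour σ (seq R T) (u , v) (okR , okT) = admissible-recolour σ R u okR , admissible-recolour σ T v okT
admissible-recolour σ (new a R) (k , u) (ok , vac) = admissible-recolour _ R u ok , binder-vacuous σ a R ∘ vac

admissible-uncolour : ∀ σ R u → Admissible (rename σ R) u → Admissible R (uncolour σ R u)
admissible-uncolour σ ◦ u ok = ok
admissible-uncolour σ (at x) k ok = ok
admissible-uncolour σ (neg x) k ok = ok
admissible-uncolour σ (par R T) (u , v) (okR , okT , compat) =
  admissible-uncolour σ R u okR , admissible-uncolour σ T v okT ,
  subst₂ Compatible (sym (marks-uncolour σ R u)) (sym (marks-uncolour σ T v)) compat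
admissible-uncolour σ (cop R T) (u , v) (okR , okT) = admissible-uncolour σ R u okR , admissible-uncolour σ T v okT
admissible-uncolour σ (seq R T) (u , v) (okR , okT) = admissible-uncolour σ R u okR , admissible-uncolour σ T v okT
admissible-uncolour σ (new a R) (k , u) (ok , vac) = admissible-uncolour _ R u ok , binder-vacuous⁻ σ a R ∘ vac

maxAtom : Str → ℕ
maxAtom = maxImg id

infix 4 _≺_
_≺_ : Str → Atom → Set
X ≺ c = maxAtom X < c

⊔-<ˡ : ∀ {m n c} → m ⊔ n < c → m < c
⊔-<ˡ {m} {n} = m⊔n<o⇒m<o m n

⊔-<ʳ : ∀ {m n c} → m ⊔ n < c → n < c
⊔-<ʳ {m} {n} = m⊔n<o⇒n<o m n

binder-≢ : ∀ a R {c} → new a R ≺ c → a ≢ c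
binder-≢ a R = <⇒≢ ∘ ⊔-<ˡ {a} {maxAtom R}

body-≺ : ∀ a R {c} → new a R ≺ c → R ≺ c
body-≺ a R = ⊔-<ʳ {a} {maxAtom R}

interpret-rename : ∀ c R σ u → σ c ≡ c → R ≺ c → rename σ R ≺ c →
  interpret c (rename σ R) u ≈ rename σ (interpret c R (uncolour σ R u))
interpret-rename c ◦ σ u σc R≺c S≺c = ≈-refl
interpret-rename c (at x) σ keep σc R≺c S≺c = ≈-refl
interpret-rename c (at x) σ delete σc R≺c S≺c = ≈-refl
interpret-rename c (neg x) σ keep σc R≺c S≺c = ≈-refl
interpret-rename c (neg x) σ delete σc R≺c S≺c = ≈-refl
interpret-rename c (par R T) σ (u , v) σc R≺c S≺c =
  ≈-par (interpret-rename c R σ u σc (⊔-<ˡ R≺c) (⊔-<ˡ S≺c))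
        (interpret-rename c T σ v σc (⊔-<ʳ R≺c) (⊔-<ʳ S≺c))
interpret-rename c (cop R T) σ (u , v) σc R≺c S≺c =
  ≈-cop (interpret-rename c R σ u σc (⊔-<ˡ R≺c) (⊔-<ˡ S≺c))
        (interpret-rename c T σ v σc (⊔-<ʳ R≺c) (⊔-<ʳ S≺c))
interpret-rename c (seq R T) σ (u , v) σc R≺c S≺c =
  ≈-seq (interpret-rename c R σ u σc (⊔-<ˡ R≺c) (⊔-<ˡ S≺c))
        (interpret-rename c T σ v σc (⊔-<ʳ R≺c) (⊔-<ʳ S≺c))
interpret-rename c (new x R) σ (k , u) σc R≺c S≺c = by-colour k
  where
  d = binder σ x R
  σ′ = σ [ x ↦ d ]
  I = interpret c R (uncolour σ′ R u)
  d≢c : d ≢ c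
  d≢c = binder-≢ d (rename σ′ R) S≺c
  IH : interpret c (rename σ′ R) u ≈ rename σ′ I
  IH = interpret-rename c R σ′ u (trans (update-miss σ x d (binder-≢ x R R≺c ∘ sym)) σc)
                        (body-≺ x R R≺c) (body-≺ d (rename σ′ R) S≺c)
  captures-nothing : ∀ {z} → z ∈fv I → z ≢ x → σ z ≢ d
  captures-nothing p z≢x with ∈fv-interpret c R _ p
  ... | inj₁ q = binder-fresh σ (new z≢x q)
  ... | inj₂ refl = λ σc≡d → d≢c (trans (sym σc≡d) σc)
  agree : Agree ([ d ≔ c ] ∘ σ′) (σ ∘ [ x ≔ c ]) I
  agree {z} p with z ≟ x
  ... | yes refl rewrite update-hit σ z d | update-hit id d c | update-hit id z c = sym σc
  ... | no z≢x rewrite update-miss σ x d z≢x | update-miss id x c z≢x =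
    update-miss id d c (captures-nothing p z≢x)
  retained-case : new d (interpret c (rename σ′ R) u) ≈ rename σ (new x I)
  retained-case = ≈-trans (≈-new IH) (≈-sym (rename-new I σ x d λ { (new z≢x p) → captures-nothing p z≢x }))
  by-colour : ∀ k → interpret c (rename σ (new x R)) (k , u) ≈
                    rename σ (interpret c (new x R) (uncolour σ (new x R) (k , u)))
  by-colour expand =
    ≈-trans (rename-≈ IH [ d ≔ c ])
    (≈-trans (rename-∘ I [ d ≔ c ] σ′)
    (≈-trans (rename-cong I _ _ agree)
             (≈-sym (rename-∘ I σ [ x ≔ c ]))))
  by-colour retain = retained-case
  by-colour vacuous = retained-case

Preimage : Atom → (P Q : Str) → Colouring Q → Set
Preimage c P Q u =
  Σ[ u′ ∈ Colouring P ] (Admissible P u′ × marks P u′ ⊆ marks Q u × (interpret c P u′ ⇝ interpret c Q u))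

Pullback : Atom → Str → Str → Set
Pullback c P Q = (u : Colouring Q) → Admissible Q u → Preimage c P Q u

pullback-refl : ∀ {c P} → Pullback c P P
pullback-refl u ok = u , ok , id , ε

pullback-trans : ∀ {c P Q R} → Pullback c P Q → Pullback c Q R → Pullback c P R
pullback-trans pq qr u ok with qr u ok
... | u₁ , ok₁ , sub₁ , p₁ with pq u₁ ok₁
...   | u₀ , ok₀ , sub₀ , p₀ = u₀ , ok₀ , sub₁ ∘ sub₀ , p₀ ◅◅ p₁

-- Pullbacks are compatible with the connectives; only par has to preserve
-- compatibility, which is why marks may only decrease.
pullback-par : ∀ {c P Q P′ Q′} → Pullback c P Q → Pullback c P′ Q′ → Pullback c (par P P′) (par Q Q′)
pullback-par pq pq′ (u , v) (ok , ok′ , compat) with pq u ok | pq′ v ok′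
... | u₀ , ok₀ , sub , p | v₀ , ok₀′ , sub′ , p′ =
  (u₀ , v₀) , (ok₀ , ok₀′ , compatible-mono sub sub′ compat) , ⊎-map sub sub′ ,
  ⇝-ctx (parL hole _) p ◅◅ ⇝-ctx (parR _ hole) p′

pullback-cop : ∀ {c P Q P′ Q′} → Pullback c P Q → Pullback c P′ Q′ → Pullback c (cop P P′) (cop Q Q′)
pullback-cop pq pq′ (u , v) (ok , ok′) with pq u ok | pq′ v ok′
... | u₀ , ok₀ , sub , p | v₀ , ok₀′ , sub′ , p′ =
  (u₀ , v₀) , (ok₀ , ok₀′) , ⊎-map sub sub′ , ⇝-ctx (copL hole _) p ◅◅ ⇝-ctx (copR _ hole) p′

pullback-seq : ∀ {c P Q P′ Q′} → Pullback c P Q → Pullback c P′ Q′ → Pullback c (seq P P′) (seq Q Q′)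
pullback-seq pq pq′ (u , v) (ok , ok′) with pq u ok | pq′ v ok′
... | u₀ , ok₀ , sub , p | v₀ , ok₀′ , sub′ , p′ =
  (u₀ , v₀) , (ok₀ , ok₀′) , ⊎-map sub sub′ , ⇝-ctx (seqL hole _) p ◅◅ ⇝-ctx (seqR _ hole) p′

-- Under a binder the vacuity condition needs that a is not free in P if it
-- is not free in Q; an expanded binder turns into a renaming of the path.
pullback-new : ∀ {c P Q} a → (a ∈fv P → a ∈fv Q) → Pullback c P Q → Pullback c (new a P) (new a Q)
pullback-new {c} {P} {Q} a fv-mono pq (k , u) (ok , vac) with pq u ok
... | u₀ , ok₀ , sub , p = (k , u₀) , (ok₀ , (λ k≡v → vac k≡v ∘ fv-mono)) , ⊎-map₂ sub , by-colour k
  where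
  by-colour : ∀ k → interpret c (new a P) (k , u₀) ⇝ interpret c (new a Q) (k , u)
  by-colour expand = ⇝-rename p [ a ≔ c ]
  by-colour retain = ⇝-ctx (newC a hole) p
  by-colour vacuous = ⇝-ctx (newC a hole) p

-- Rules and ≈-steps never create free atoms in the premise: the free atoms
-- of P are free in Q.  This is what vacuity conditions of enclosing binders need.
FvMono : Str → Str → Set
FvMono P Q = ∀ {y} → y ∈fv P → y ∈fv Q

fv-mono-plug : ∀ S {P Q} → FvMono P Q → FvMono (S ⟦ P ⟧) (S ⟦ Q ⟧)
fv-mono-plug hole m p = m p
fv-mono-plug (parL S T) m (parˡ p) = parˡ (fv-mono-plug S m p)
fv-mono-plug (parL S T) m (parʳ p) = parʳ p
fv-mono-plug (parR T S) m (parˡ p) = parˡ p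
fv-mono-plug (parR T S) m (parʳ p) = parʳ (fv-mono-plug S m p)
fv-mono-plug (copL S T) m (copˡ p) = copˡ (fv-mono-plug S m p)
fv-mono-plug (copL S T) m (copʳ p) = copʳ p
fv-mono-plug (copR T S) m (copˡ p) = copˡ p
fv-mono-plug (copR T S) m (copʳ p) = copʳ (fv-mono-plug S m p)
fv-mono-plug (seqL S T) m (seqˡ p) = seqˡ (fv-mono-plug S m p)
fv-mono-plug (seqL S T) m (seqʳ p) = seqʳ p
fv-mono-plug (seqR T S) m (seqˡ p) = seqˡ p
fv-mono-plug (seqR T S) m (seqʳ p) = seqʳ (fv-mono-plug S m p)
fv-mono-plug (newC a S) m (new y≢a p) = new y≢a (fv-mono-plug S m p)

pullback-plug : ∀ {c} S {P Q} → FvMono P Q → Pullback c P Q → Pullback c (S ⟦ P ⟧) (S ⟦ Q ⟧)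
pullback-plug hole m pq = pq
pullback-plug (parL S T) m pq = pullback-par (pullback-plug S m pq) pullback-refl
pullback-plug (parR T S) m pq = pullback-par pullback-refl (pullback-plug S m pq)
pullback-plug (copL S T) m pq = pullback-cop (pullback-plug S m pq) pullback-refl
pullback-plug (copR T S) m pq = pullback-cop pullback-refl (pullback-plug S m pq)
pullback-plug (seqL S T) m pq = pullback-seq (pullback-plug S m pq) pullback-refl
pullback-plug (seqR T S) m pq = pullback-seq pullback-refl (pullback-plug S m pq)
pullback-plug (newC a S) m pq = pullback-new a (fv-mono-plug S m) (pullback-plug S m pq)

expand-vacuous : ∀ {a c} I → a ∉fv I → I ⟪ c / a ⟫ ≈ new a I
expand-vacuous I a∉I = ≈-trans (⟪⟫-vacuous I a∉I) (≈-sym (new-vac (∉fv⇒fresh I a∉I)))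

ai-pullback : ∀ {c} a → Pullback c ◦ (par (at a) (neg a))
ai-pullback a (keep , keep) _ = tt , tt , (λ ()) , ⇝-rule (ai↓ hole a)
ai-pullback a (delete , delete) _ = tt , tt , (λ ()) , ⇝-≈ (≈-sym par-unit)
ai-pullback a (keep , delete) (_ , _ , compat) = ⊥-elim (compat kept-deleted refl refl)
ai-pullback a (delete , keep) (_ , _ , compat) = ⊥-elim (compat deleted-kept refl refl)

s-pullback : ∀ {c} R T U → Pullback c (cop (par R U) T) (par (cop R T) U)
s-pullback R T U ((uR , uT) , uU) ((okR , okT) , okU , compat) =
  ((uR , uU) , uT) , ((okR , okU , compatible-mono inj₁ id compat) , okT) ,
  [ [ inj₁ ∘ inj₁ , inj₂ ]′ , inj₁ ∘ inj₂ ]′ , ⇝-rule (s hole _ _ _)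

q-pullback : ∀ {c} R T U V → Pullback c (seq (par R U) (par T V)) (par (seq R T) (seq U V))
q-pullback R T U V ((uR , uT) , (uU , uV)) ((okR , okT) , (okU , okV) , compat) =
  ((uR , uU) , (uT , uV)) ,
  ((okR , okU , compatible-mono inj₁ inj₁ compat) , (okT , okV , compatible-mono inj₂ inj₂ compat)) ,
  [ ⊎-map inj₁ inj₁ , ⊎-map inj₂ inj₂ ]′ , ⇝-rule (q↓ hole _ _ _ _)

-- For r↓ the premise binder takes the colour of the two conclusion binders;
-- an expanded and a retained one cannot meet, and a vacuous binder next to an
-- expanded one is expanded as well (this needs a ≢ c).
r-pullback : ∀ {c} a R T → a ≢ c → Pullback c (new a (par R T)) (par (new a R) (new a T))
r-pullback {c} a R T a≢c ((k₁ , uR) , (k₂ , uT)) ((okR , vac₁) , (okT , vac₂) , compat) =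
  by-colours k₁ k₂ vac₁ vac₂ compat
  where
  IR = interpret c R uR
  IT = interpret c T uT
  premise : ∀ k₁ k₂ k → (k ≡ vacuous → a ∉fv par R T) → binderMarks k ⊆ binderMarks k₁ ∪ binderMarks k₂ →
            interpret c (new a (par R T)) (k , (uR , uT)) ⇝ par (interpret c (new a R) (k₁ , uR)) (interpret c (new a T) (k₂ , uT)) →
            Preimage c (new a (par R T)) (par (new a R) (new a T)) ((k₁ , uR) , (k₂ , uT))
  premise k₁ k₂ k vac sub p =
    (k , (uR , uT)) , ((okR , okT , compatible-mono inj₂ inj₂ compat) , vac) ,
    [ [ inj₁ ∘ inj₁ , inj₂ ∘ inj₁ ]′ ∘ sub , ⊎-map inj₂ inj₂ ]′ , p
  by-colours : ∀ k₁ k₂ → (k₁ ≡ vacuous → a ∉fv R) → (k₂ ≡ vacuous → a ∉fv T) →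
               Compatible (binderMarks k₁ ∪ marks R uR) (binderMarks k₂ ∪ marks T uT) →
               Preimage c (new a (par R T)) (par (new a R) (new a T)) ((k₁ , uR) , (k₂ , uT))
  by-colours expand expand _ _ _ = premise expand expand expand (λ ()) inj₁ ε
  by-colours expand retain _ _ compat = ⊥-elim (compat expanded-retained (inj₁ refl) (inj₁ refl))
  by-colours retain expand _ _ compat = ⊥-elim (compat retained-expanded (inj₁ refl) (inj₁ refl))
  by-colours retain retain _ _ _ = premise retain retain retain (λ ()) inj₁ (⇝-rule (r↓ hole a IR IT))
  by-colours retain vacuous _ _ _ = premise retain vacuous retain (λ ()) inj₁ (⇝-rule (r↓ hole a IR IT))
  by-colours vacuous retain _ _ _ = premise vacuous retain retain (λ ()) inj₂ (⇝-rule (r↓ hole a IR IT))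
  by-colours vacuous vacuous vac₁ vac₂ _ =
    premise vacuous vacuous vacuous (λ _ → λ { (parˡ p) → vac₁ refl p ; (parʳ p) → vac₂ refl p }) (λ ()) (⇝-rule (r↓ hole a IR IT))
  by-colours vacuous expand vac₁ _ _ =
    premise vacuous expand expand (λ ()) inj₂ (⇝-ctx (parL hole _) (⇝-≈ (expand-vacuous IR (∉fv-interpret c R uR (vac₁ refl) a≢c))))
  by-colours expand vacuous _ vac₂ _ =
    premise expand vacuous expand (λ ()) inj₁ (⇝-ctx (parR _ hole) (⇝-≈ (expand-vacuous IT (∉fv-interpret c T uT (vac₂ refl) a≢c))))

-- The only atom a rule instance requires c to avoid is the binder of r↓.
ruleAtom : ∀ {P Q} → Rule P Q → ℕ
ruleAtom (r↓ S a R T) = a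
ruleAtom _ = 0

rule-pullback : ∀ {c P Q} (r : Rule P Q) → ruleAtom r < c → Pullback c P Q
rule-pullback (ai↓ S a) _ = pullback-plug S (λ ()) (ai-pullback a)
rule-pullback (s S R T U) _ = pullback-plug S
  (λ { (copˡ (parˡ p)) → parˡ (copˡ p) ; (copˡ (parʳ p)) → parʳ p ; (copʳ p) → parˡ (copʳ p) })
  (s-pullback R T U)
rule-pullback (q↓ S R T U V) _ = pullback-plug S
  (λ { (seqˡ (parˡ p)) → parˡ (seqˡ p) ; (seqˡ (parʳ p)) → parʳ (seqˡ p)
     ; (seqʳ (parˡ p)) → parˡ (seqʳ p) ; (seqʳ (parʳ p)) → parʳ (seqʳ p) })
  (q-pullback R T U V)
rule-pullback (r↓ S a R T) a<c = pullback-plug S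
  (λ { (new y≢a (parˡ p)) → parˡ (new y≢a p) ; (new y≢a (parʳ p)) → parʳ (new y≢a p) })
  (r-pullback a R T (<⇒≢ a<c))

Pullbacks : Atom → Str → Str → Set
Pullbacks c P Q = Pullback c P Q × Pullback c Q P

par-assoc-pullbacks : ∀ {c} R T U → Pullbacks c (par (par R T) U) (par R (par T U))
par-assoc-pullbacks R T U =
  (λ { (uR , (uT , uU)) (okR , (okT , okU , cTU) , cR-TU) →
       ((uR , uT) , uU) ,
       ((okR , okT , compatible-mono id inj₁ cR-TU) , okU , compatible-∪ (compatible-mono id inj₂ cR-TU) cTU) ,
       ⊎-assocʳ , ⇝-≈ par-assoc }) ,
  (λ { ((uR , uT) , uU) ((okR , okT , cRT) , okU , cRT-U) →
       (uR , (uT , uU)) ,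
       (okR , (okT , okU , compatible-mono inj₂ id cRT-U) ,
        compatible-sym (compatible-∪ (compatible-sym cRT) (compatible-sym (compatible-mono inj₁ id cRT-U)))) ,
       ⊎-assocˡ , ⇝-≈ (≈-sym par-assoc) })

cop-assoc-pullbacks : ∀ {c} R T U → Pullbacks c (cop (cop R T) U) (cop R (cop T U))
cop-assoc-pullbacks R T U =
  (λ u ok → assocˡ′ u , assocˡ′ ok , ⊎-assocʳ , ⇝-≈ cop-assoc) ,
  (λ u ok → assocʳ′ u , assocʳ′ ok , ⊎-assocˡ , ⇝-≈ (≈-sym cop-assoc))

seq-assoc-pullbacks : ∀ {c} R T U → Pullbacks c (seq (seq R T) U) (seq R (seq T U))
seq-assoc-pullbacks R T U =
  (λ u ok → assocˡ′ u , assocˡ′ ok , ⊎-assocʳ , ⇝-≈ seq-assoc) ,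
  (λ u ok → assocʳ′ u , assocʳ′ ok , ⊎-assocˡ , ⇝-≈ (≈-sym seq-assoc))

par-unit-pullbacks : ∀ {c} R → Pullbacks c (par ◦ R) R
par-unit-pullbacks R =
  (λ u ok → (tt , u) , (tt , ok , λ _ ()) , [ (λ ()) , id ]′ , ⇝-≈ par-unit) ,
  (λ { (_ , u) (_ , ok , _) → u , ok , inj₂ , ⇝-≈ (≈-sym par-unit) })

cop-unit-pullbacks : ∀ {c} R → Pullbacks c (cop ◦ R) R
cop-unit-pullbacks R =
  (λ u ok → (tt , u) , (tt , ok) , [ (λ ()) , id ]′ , ⇝-≈ cop-unit) ,
  (λ { (_ , u) (_ , ok) → u , ok , inj₂ , ⇝-≈ (≈-sym cop-unit) })

seq-unitˡ-pullbacks : ∀ {c} R → Pullbacks c (seq ◦ R) R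
seq-unitˡ-pullbacks R =
  (λ u ok → (tt , u) , (tt , ok) , [ (λ ()) , id ]′ , ⇝-≈ seq-unitˡ) ,
  (λ { (_ , u) (_ , ok) → u , ok , inj₂ , ⇝-≈ (≈-sym seq-unitˡ) })

seq-unitʳ-pullbacks : ∀ {c} R → Pullbacks c (seq R ◦) R
seq-unitʳ-pullbacks R =
  (λ u ok → (u , tt) , (ok , tt) , [ id , (λ ()) ]′ , ⇝-≈ seq-unitʳ) ,
  (λ { (u , _) (ok , _) → u , ok , inj₁ , ⇝-≈ (≈-sym seq-unitʳ) })

par-comm-pullback : ∀ {c} R T → Pullback c (par R T) (par T R)
par-comm-pullback R T (uT , uR) (okT , okR , compat) =
  (uR , uT) , (okR , okT , compatible-sym compat) , ⊎-swap , ⇝-≈ par-comm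

cop-comm-pullback : ∀ {c} R T → Pullback c (cop R T) (cop T R)
cop-comm-pullback R T (uT , uR) (okT , okR) = (uR , uT) , (okR , okT) , ⊎-swap , ⇝-≈ cop-comm

interpret-α : ∀ c a b R → b ∉fv R → new a R ≺ c → new b (R ⟪ b / a ⟫) ≺ c → ∀ k u →
  interpret c (new a R) (k , uncolour [ a ≔ b ] R u) ≈ interpret c (new b (R ⟪ b / a ⟫)) (k , u)
interpret-α c a b R b∉R aR≺c bR≺c k u = by-colour k
  where
  σ = [ a ≔ b ]
  X = interpret c R (uncolour σ R u)
  b≢c : b ≢ c
  b≢c = binder-≢ b (R ⟪ b / a ⟫) bR≺c
  interpret-σ : interpret c (R ⟪ b / a ⟫) u ≈ X ⟪ b / a ⟫
  interpret-σ = interpret-rename c R σ u (update-miss id a b (binder-≢ a R aR≺c ∘ sym))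
                                 (body-≺ a R aR≺c) (body-≺ b (R ⟪ b / a ⟫) bR≺c)
  agree : Agree ([ b ≔ c ] ∘ σ) [ a ≔ c ] X
  agree {z} p with z ≟ a
  ... | yes refl rewrite update-hit id z b | update-hit id b c | update-hit id z c = refl
  ... | no z≢a rewrite update-miss id a b z≢a | update-miss id a c z≢a = update-miss id b c z≢b
    where
    z≢b : z ≢ b
    z≢b with ∈fv-interpret c R _ p
    ... | inj₁ q = λ { refl → b∉R q }
    ... | inj₂ refl = b≢c ∘ sym
  retained-case : new a X ≈ new b (interpret c (R ⟪ b / a ⟫) u)
  retained-case = ≈-trans (new-α (∉fv⇒fresh X (∉fv-interpret c R _ b∉R b≢c))) (≈-new (≈-sym interpret-σ))
  by-colour : ∀ k → interpret c (new a R) (k , uncolour σ R u) ≈ interpret c (new b (R ⟪ b / a ⟫)) (k , u)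
  by-colour expand =
    ≈-sym (≈-trans (rename-≈ interpret-σ [ b ≔ c ]) (≈-trans (rename-∘ X [ b ≔ c ] σ) (rename-cong X _ _ agree)))
  by-colour retain = retained-case
  by-colour vacuous = retained-case

α-pullbacks : ∀ {c} a b R → freeIn b R ≡ false → new a R ≺ c → new b (R ⟪ b / a ⟫) ≺ c →
              Pullbacks c (new a R) (new b (R ⟪ b / a ⟫))
α-pullbacks {c} a b R b-fresh aR≺c bR≺c = to-a , to-b
  where
  σ = [ a ≔ b ]
  b∉R : b ∉fv R
  b∉R = fresh⇒∉fv b-fresh
  α-equation : ∀ k u → interpret c (new a R) (k , uncolour σ R u) ≈ interpret c (new b (R ⟪ b / a ⟫)) (k , u)
  α-equation = interpret-α c a b R b∉R aR≺c bR≺c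
  to-a : Pullback c (new a R) (new b (R ⟪ b / a ⟫))
  to-a (k , u) (ok , vac) =
    (k , uncolour σ R u) ,
    (admissible-uncolour σ R u ok ,
     λ k≡v a∈R → vac k≡v (subst (_∈fv R ⟪ b / a ⟫) (update-hit id a b) (∈fv-rename σ a∈R))) ,
    ⊎-map₂ (⊆-≡ (marks-uncolour σ R u)) , ⇝-≈ (α-equation k u)
  to-b : Pullback c (new b (R ⟪ b / a ⟫)) (new a R)
  to-b (k , u) (ok , vac) =
    (k , recolour σ R u) ,
    (admissible-recolour σ R u ok ,
     λ k≡v p → [ (λ (_ , a∈R) → vac k≡v a∈R) , (λ (_ , b∈R) → b∉R b∈R) ]′ (∈fv-⟪⟫⁻ R p)) ,
    ⊎-map₂ (⊆-≡ (marks-recolour σ R u)) ,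
    ⇝-≈ (≈-sym (subst (λ w → interpret c (new a R) (k , w) ≈ interpret c (new b (R ⟪ b / a ⟫)) (k , recolour σ R u))
                      (uncolour-recolour σ R u) (α-equation k (recolour σ R u))))

vac-pullbacks : ∀ {c} a R → freeIn a R ≡ false → new a R ≺ c → Pullbacks c (new a R) R
vac-pullbacks {c} a R a-fresh aR≺c = add-binder , drop-binder
  where
  a∉R : a ∉fv R
  a∉R = fresh⇒∉fv a-fresh
  a∉I : ∀ u → a ∉fv interpret c R u
  a∉I u = ∉fv-interpret c R u a∉R (binder-≢ a R aR≺c)
  add-binder : Pullback c (new a R) R
  add-binder u ok = (vacuous , u) , (ok , λ _ → a∉R) , [ (λ ()) , id ]′ , ⇝-≈ (new-vac (∉fv⇒fresh _ (a∉I u)))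
  binder-vanishes : ∀ k u → interpret c (new a R) (k , u) ≈ interpret c R u
  binder-vanishes expand u = ⟪⟫-vacuous _ (a∉I u)
  binder-vanishes retain u = new-vac (∉fv⇒fresh _ (a∉I u))
  binder-vanishes vacuous u = new-vac (∉fv⇒fresh _ (a∉I u))
  drop-binder : Pullback c R (new a R)
  drop-binder (k , u) (ok , _) = u , ok , inj₂ , ⇝-≈ (≈-sym (binder-vanishes k u))

swap-pullback : ∀ {c} a b R → a ≢ b → a ≢ c → b ≢ c → Pullback c (new a (new b R)) (new b (new a R))
swap-pullback {c} a b R a≢b a≢c b≢c (k₂ , (k₁ , u)) ((ok , vac₁) , vac₂) =
  (k₁ , (k₂ , u)) ,
  ((ok , λ k≡v p → vac₂ k≡v (new (a≢b ∘ sym) p)) , λ { k≡v (new _ p) → vac₁ k≡v p }) ,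
  [ inj₂ ∘ inj₁ , ⊎-map₂ inj₂ ]′ , ⇝-≈ (by-colours k₁ k₂)
  where
  X = interpret c R u
  substitutions-commute : ∀ z → [ a ≔ c ] ([ b ≔ c ] z) ≡ [ b ≔ c ] ([ a ≔ c ] z)
  substitutions-commute z with z ≟ a | z ≟ b
  ... | yes refl | yes refl = ⊥-elim (a≢b refl)
  ... | yes refl | no z≢b =
    trans (cong [ a ≔ c ] (update-miss id b c z≢b)) (trans (update-hit id z c)
    (sym (trans (cong [ b ≔ c ] (update-hit id z c)) (update-miss id b c (b≢c ∘ sym)))))
  ... | no z≢a | yes refl =
    trans (cong [ a ≔ c ] (update-hit id z c)) (trans (update-miss id a c (a≢c ∘ sym))
    (sym (trans (cong [ b ≔ c ] (update-miss id a c z≢a)) (update-hit id z c))))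
  ... | no z≢a | no z≢b =
    trans (cong [ a ≔ c ] (update-miss id b c z≢b)) (trans (update-miss id a c z≢a)
    (sym (trans (cong [ b ≔ c ] (update-miss id a c z≢a)) (update-miss id b c z≢b))))
  by-colours : ∀ k₁ k₂ → interpret c (new a (new b R)) (k₁ , (k₂ , u)) ≈ interpret c (new b (new a R)) (k₂ , (k₁ , u))
  by-colours expand expand =
    ≈-trans (rename-∘ X _ _) (≈-trans (rename-cong X _ _ (λ {z} _ → substitutions-commute z)) (≈-sym (rename-∘ X _ _)))
  by-colours expand retain = ⟪⟫-under X a≢b b≢c
  by-colours expand vacuous = ⟪⟫-under X a≢b b≢c
  by-colours retain expand = ≈-sym (⟪⟫-under X (a≢b ∘ sym) a≢c)
  by-colours vacuous expand = ≈-sym (⟪⟫-under X (a≢b ∘ sym) a≢c)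
  by-colours retain retain = new-swap
  by-colours retain vacuous = new-swap
  by-colours vacuous retain = new-swap
  by-colours vacuous vacuous = new-swap

-- The largest atom occurring in the renaming axioms (α-conversion, vacuous
-- binder, exchange) used by an equivalence proof; only these constrain c.
maxAtom≈ : ∀ {P Q} → P ≈ Q → ℕ
maxAtom≈ (≈-sym e) = maxAtom≈ e
maxAtom≈ (≈-trans e e′) = maxAtom≈ e ⊔ maxAtom≈ e′
maxAtom≈ (≈-par e e′) = maxAtom≈ e ⊔ maxAtom≈ e′
maxAtom≈ (≈-cop e e′) = maxAtom≈ e ⊔ maxAtom≈ e′
maxAtom≈ (≈-seq e e′) = maxAtom≈ e ⊔ maxAtom≈ e′
maxAtom≈ (≈-new e) = maxAtom≈ e
maxAtom≈ (new-α {a} {b} {R} _) = maxAtom (new a R) ⊔ maxAtom (new b (R ⟪ b / a ⟫))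
maxAtom≈ (new-vac {a} {R} _) = maxAtom (new a R)
maxAtom≈ (new-swap {a} {b} {R}) = maxAtom (new a (new b R))
maxAtom≈ _ = 0

pullback-≈ : ∀ {c P Q} (e : P ≈ Q) → maxAtom≈ e < c → Pullbacks c P Q
pullback-≈ ≈-refl _ = pullback-refl , pullback-refl
pullback-≈ (≈-sym e) lt = ×-swap (pullback-≈ e lt)
pullback-≈ (≈-trans e e′) lt with pullback-≈ e (⊔-<ˡ lt) | pullback-≈ e′ (⊔-<ʳ lt)
... | f , g | f′ , g′ = pullback-trans f f′ , pullback-trans g′ g
pullback-≈ (≈-par e e′) lt with pullback-≈ e (⊔-<ˡ lt) | pullback-≈ e′ (⊔-<ʳ lt)
... | f , g | f′ , g′ = pullback-par f f′ , pullback-par g g′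
pullback-≈ (≈-cop e e′) lt with pullback-≈ e (⊔-<ˡ lt) | pullback-≈ e′ (⊔-<ʳ lt)
... | f , g | f′ , g′ = pullback-cop f f′ , pullback-cop g g′
pullback-≈ (≈-seq e e′) lt with pullback-≈ e (⊔-<ˡ lt) | pullback-≈ e′ (⊔-<ʳ lt)
... | f , g | f′ , g′ = pullback-seq f f′ , pullback-seq g g′
pullback-≈ (≈-new {a} e) lt with pullback-≈ e lt
... | f , g = pullback-new a (∈fv-≈ e) f , pullback-new a (∈fv-≈ (≈-sym e)) g
pullback-≈ (par-assoc {R} {T} {U}) _ = par-assoc-pullbacks R T U
pullback-≈ (cop-assoc {R} {T} {U}) _ = cop-assoc-pullbacks R T U
pullback-≈ (seq-assoc {R} {T} {U}) _ = seq-assoc-pullbacks R T U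
pullback-≈ (par-unit {R}) _ = par-unit-pullbacks R
pullback-≈ (cop-unit {R}) _ = cop-unit-pullbacks R
pullback-≈ (seq-unitˡ {R}) _ = seq-unitˡ-pullbacks R
pullback-≈ (seq-unitʳ {R}) _ = seq-unitʳ-pullbacks R
pullback-≈ (par-comm {R} {T}) _ = par-comm-pullback R T , par-comm-pullback T R
pullback-≈ (cop-comm {R} {T}) _ = cop-comm-pullback R T , cop-comm-pullback T R
pullback-≈ (new-α {a} {b} {R} b-fresh) lt = α-pullbacks a b R b-fresh (⊔-<ˡ lt) (⊔-<ʳ {maxAtom (new a R)} lt)
pullback-≈ (new-vac {a} {R} a-fresh) lt = vac-pullbacks a R a-fresh lt
pullback-≈ (new-swap {a} {b} {R}) lt with a ≟ b
... | yes refl = pullback-refl {P = new a (new a R)} , pullback-refl {P = new a (new a R)}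
... | no a≢b = swap-pullback a b R a≢b a≢c b≢c , swap-pullback b a R (a≢b ∘ sym) b≢c a≢c
  where
  a≢c = binder-≢ a (new b R) lt
  b≢c = binder-≢ b R (body-≺ a (new b R) lt)

maxAtom⊢ : ∀ {X} → ⊢ X → ℕ
maxAtom⊢ start = 0
maxAtom⊢ (step d r) = maxAtom⊢ d ⊔ ruleAtom r
maxAtom⊢ (conv d e) = maxAtom⊢ d ⊔ maxAtom≈ e

interpret-⊢ : ∀ {c X} (d : ⊢ X) → maxAtom⊢ d < c → (u : Colouring X) → Admissible X u → ⊢ interpret c X u
interpret-⊢ start _ u ok = start
interpret-⊢ (step d r) lt u ok with rule-pullback r (⊔-<ʳ lt) u ok
... | u′ , ok′ , _ , p = extend (interpret-⊢ d (⊔-<ˡ lt) u′ ok′) p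
interpret-⊢ (conv d e) lt u ok with proj₁ (pullback-≈ e (⊔-<ʳ lt)) u ok
... | u′ , ok′ , _ , p = extend (interpret-⊢ d (⊔-<ˡ lt) u′ ok′) p

uniform : AtomColour → (X : Str) → Colouring X
uniform κ ◦ = tt
uniform κ (at x) = κ
uniform κ (neg x) = κ
uniform κ (par R T) = uniform κ R , uniform κ T
uniform κ (cop R T) = uniform κ R , uniform κ T
uniform κ (seq R T) = uniform κ R , uniform κ T
uniform κ (new a R) = retain , uniform κ R

uniform-marks : ∀ κ X → marks X (uniform κ X) ⊆ atomMarks κ ∪ binderMarks retain
uniform-marks κ ◦ ()
uniform-marks κ (at x) = inj₁
uniform-marks κ (neg x) = inj₁
uniform-marks κ (par R T) = [ uniform-marks κ R , uniform-marks κ T ]′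
uniform-marks κ (cop R T) = [ uniform-marks κ R , uniform-marks κ T ]′
uniform-marks κ (seq R T) = [ uniform-marks κ R , uniform-marks κ T ]′
uniform-marks κ (new a R) = [ inj₂ , uniform-marks κ R ]′

uniform-compatible : ∀ κ → Compatible (atomMarks κ ∪ binderMarks retain) (atomMarks κ ∪ binderMarks retain)
uniform-compatible keep () (inj₁ refl) (inj₁ refl)
uniform-compatible keep () (inj₁ refl) (inj₂ refl)
uniform-compatible keep () (inj₂ refl) (inj₁ refl)
uniform-compatible keep () (inj₂ refl) (inj₂ refl)
uniform-compatible delete () (inj₁ refl) (inj₁ refl)
uniform-compatible delete () (inj₁ refl) (inj₂ refl)
uniform-compatible delete () (inj₂ refl) (inj₁ refl)
uniform-compatible delete () (inj₂ refl) (inj₂ refl)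

uniform-admissible : ∀ κ X → Admissible X (uniform κ X)
uniform-admissible κ ◦ = tt
uniform-admissible κ (at x) = tt
uniform-admissible κ (neg x) = tt
uniform-admissible κ (par R T) =
  uniform-admissible κ R , uniform-admissible κ T ,
  compatible-mono (uniform-marks κ R) (uniform-marks κ T) (uniform-compatible κ)
uniform-admissible κ (cop R T) = uniform-admissible κ R , uniform-admissible κ T
uniform-admissible κ (seq R T) = uniform-admissible κ R , uniform-admissible κ T
uniform-admissible κ (new a R) = uniform-admissible κ R , λ ()

interpret-keep : ∀ c X → interpret c X (uniform keep X) ≡ X
interpret-keep c ◦ = refl
interpret-keep c (at x) = refl
interpret-keep c (neg x) = refl
interpret-keep c (par R T) = cong₂ par (interpret-keep c R) (interpret-keep c T)
interpret-keep c (cop R T) = cong₂ cop (interpret-keep c R) (interpret-keep c T)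
interpret-keep c (seq R T) = cong₂ seq (interpret-keep c R) (interpret-keep c T)
interpret-keep c (new a R) = cong (new a) (interpret-keep c R)

interpret-delete : ∀ c X → interpret c X (uniform delete X) ≈ ◦
interpret-delete c ◦ = ≈-refl
interpret-delete c (at x) = ≈-refl
interpret-delete c (neg x) = ≈-refl
interpret-delete c (par R T) = ≈-trans (≈-par (interpret-delete c R) (interpret-delete c T)) par-unit
interpret-delete c (cop R T) = ≈-trans (≈-cop (interpret-delete c R) (interpret-delete c T)) cop-unit
interpret-delete c (seq R T) = ≈-trans (≈-seq (interpret-delete c R) (interpret-delete c T)) seq-unitˡ
interpret-delete c (new a R) = ≈-trans (≈-new (interpret-delete c R)) (new-vac refl)

≡⇒≈ : ∀ {X Y} → X ≡ Y → X ≈ Y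
≡⇒≈ refl = ≈-refl

seq-elim : ∀ {R T} → ⊢ seq R T → (⊢ R) × (⊢ T)
seq-elim {R} {T} d =
  conv (restrict keep delete) (≈-trans (≈-seq (≡⇒≈ (interpret-keep c R)) (interpret-delete c T)) seq-unitʳ) ,
  conv (restrict delete keep) (≈-trans (≈-seq (interpret-delete c R) (≡⇒≈ (interpret-keep c T))) seq-unitˡ)
  where
  c = suc (maxAtom⊢ d)
  restrict : ∀ κ κ′ → ⊢ seq (interpret c R (uniform κ R)) (interpret c T (uniform κ′ T))
  restrict κ κ′ = interpret-⊢ d ≤-refl (uniform κ R , uniform κ′ T) (uniform-admissible κ R , uniform-admissible κ′ T)

cop-elim : ∀ {R T} → ⊢ cop R T → (⊢ R) × (⊢ T)
cop-elim {R} {T} d =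
  conv (restrict keep delete) (≈-trans (≈-cop (≡⇒≈ (interpret-keep c R)) (interpret-delete c T)) (≈-trans cop-comm cop-unit)) ,
  conv (restrict delete keep) (≈-trans (≈-cop (interpret-delete c R) (≡⇒≈ (interpret-keep c T))) cop-unit)
  where
  c = suc (maxAtom⊢ d)
  restrict : ∀ κ κ′ → ⊢ cop (interpret c R (uniform κ R)) (interpret c T (uniform κ′ T))
  restrict κ κ′ = interpret-⊢ d ≤-refl (uniform κ R , uniform κ′ T) (uniform-admissible κ R , uniform-admissible κ′ T)

-- Expanding the outer binder with a fresh c proves R ⟪ c / a ⟫; renaming c
-- to b then gives every instance.
new-elim : ∀ {a R} → ⊢ new a R → ∀ b → ⊢ R ⟪ b / a ⟫
new-elim {a} {R} d b =
  conv (⊢-rename ⊢R⟪c/a⟫ [ c ≔ b ]) (≈-trans (rename-∘ R [ c ≔ b ] [ a ≔ c ]) (rename-cong R _ _ agree))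
  where
  c = suc (maxAtom (new a R) ⊔ maxAtom⊢ d)
  ⊢R⟪c/a⟫ : ⊢ R ⟪ c / a ⟫
  ⊢R⟪c/a⟫ = subst (λ Z → ⊢ Z ⟪ c / a ⟫) (interpret-keep c R)
              (interpret-⊢ d (s≤s (m≤n⊔m _ _)) (expand , uniform keep R) (uniform-admissible keep R , λ ()))
  agree : Agree ([ c ≔ b ] ∘ [ a ≔ c ]) [ a ≔ b ] R
  agree {z} p with z ≟ a
  ... | yes refl = trans (cong [ c ≔ b ] (update-hit id z c)) (trans (update-hit id c b) (sym (update-hit id z b)))
  ... | no z≢a =
    trans (cong [ c ≔ b ] (update-miss id a c z≢a)) (trans (update-miss id c b z≢c) (sym (update-miss id a b z≢a)))
    where
    z≢c : z ≢ c
    z≢c = <⇒≢ (s≤s (≤-trans (∈fv-maxImg id (new z≢a p)) (m≤m⊔n _ _)))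

-- Conversely an instance at an atom b not occurring in R α-converts to new a R.
new-from-instances : ∀ {a R} → (∀ b → ⊢ R ⟪ b / a ⟫) → ⊢ new a R
new-from-instances {a} {R} instances = conv (new-intro b (instances b)) (≈-sym (new-α (∉fv⇒fresh R b∉R)))
  where
  b = suc (maxAtom R)
  b∉R : b ∉fv R
  b∉R p = n≮n (maxAtom R) (∈fv-maxImg id p)

mainTheorem9 : (R T : Str) (a : Atom) →
    ((⊢ seq R T) ⇔ ((⊢ R) × (⊢ T)))
  × ((⊢ cop R T) ⇔ ((⊢ R) × (⊢ T)))
  × ((⊢ new a R) ⇔ ((b : Atom) → ⊢ R ⟪ b / a ⟫))
mainTheorem9 R T a =
    mk⇔ seq-elim (λ (dR , dT) → seq-intro dR dT)
  , mk⇔ cop-elim (λ (dR , dT) → cop-intro dR dT)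
  , mk⇔ new-elim new-from-instances
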